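{- Let $g,h,v,e$ be nonnegative integers. In $PG(4,2)$ fix a chain $l_0\subset E_0\subset H_0$ where $l_0$ is a line, $E_0$ a plane and $H_0$ a hyperplane (solid). Let $\mathcal{V}$ be a set of $8$ lines such that each point of $E_0\setminus l_0$ lies on exactly two lines of $\mathcal{V}$ and each point outside $H_0$ lies on exactly one line of $\mathcal{V}$, and let $\mathcal{E}$ be a set of $8$ lines partitioning the $24$ points of $PG(4,2)$ outside $E_0$. Let $C(g,h,v,e)$ be the additive quaternary code associated with the multiset of lines consisting of $l_0$ with multiplicity $g$, each of the other $6$ lines of $E_0$ with multiplicity $h$, each line of $\mathcal{V}$ with multiplicity $v$, and each line of $\mathcal{E}$ with multiplicity $e$. Then the weights of the codewords of $C(g,h,v,e)$ associated with nonzero linear functionals are $$g+5h+6(v+e),\quad 6h+8v+6e,\quad 4v+8e,\quad 8(v+e),$$ and $C(g,h,v,e)$ is an additive quaternary $[g+6h+8(v+e),2.5,d]$-code with $$d=\min\bigl(g+5h+6(v+e),\ 6h+8v+6e,\ 4v+8e\bigr).$$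
   Context: An additive quaternary $[n,k,d]$-code is a $2k$-dimensional $\mathbb{F}_2$-linear subspace of $\mathbb{F}_2^{2n}$ whose coordinates are grouped into $n$ pairs, codewords being viewed as $n$-tuples with entries in $\mathbb{F}_2^2$, with $d$ the minimum Hamming distance over these $n$ symbols. $PG(4,2)$ is the projective space of $\mathbb{F}_2^5$; lines are $2$-dimensional subspaces. The code associated with a multiset $L_1,\dots,L_n$ of lines of $PG(4,2)$ (listed with multiplicity) is defined as follows: choose for each $L_i$ a basis $a_i,b_i$ of the corresponding $2$-dimensional subspace of $\mathbb{F}_2^5$; to each linear functional $f:\mathbb{F}_2^5\to\mathbb{F}_2$ associate the codeword $\bigl((f(a_1),f(b_1)),\dots,(f(a_n),f(b_n))\bigr)$. The weight of this codeword is $n$ minus the number of $i$ with $L_i$ contained in the hyperplane $\ker f$. -}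

module Defs where

open import Data.Bool using (Bool; true; false; _∧_; _∨_; _xor_; if_then_else_)
open import Data.Bool.Properties using () renaming (_≟_ to _≟B_)
open import Data.Nat using (ℕ; zero; suc; _+_; _*_)
open import Data.List using (List; []; _∷_; _++_; map; replicate; concat)
open import Data.Vec using (Vec; zipWith; foldr; replicate; toList; lookup)
open import Data.Vec.Properties using (≡-dec)
open import Data.Fin using (Fin)
open import Data.Product using (_×_; _,_; ∃-syntax)
open import Relation.Nullary using (¬_; does)
open import Relation.Binary.PropositionalEquality using (_≡_; _≢_)

-- The vector space F₂⁵.  Points of PG(4,2) are the nonzero vectors.

V5 : Set
V5 = Vec Bool 5

0v : V5
0v = Data.Vec.replicate 5 false

_⊕_ : V5 → V5 → V5
_⊕_ = zipWith _xor_

_·_ : Bool → V5 → V5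
x · u = if x then u else 0v

_==_ : V5 → V5 → Bool
u == w = does (≡-dec _≟B_ u w)

-- Linear functionals F₂⁵ → F₂ are identified with vectors via the
-- standard dot product: the functional of f is  x ↦ dot f x.
dot : V5 → V5 → Bool
dot f x = foldr _ _xor_ false (zipWith _∧_ f x)

-- Lines of PG(4,2): 2-dimensional subspaces, given by a basis a, b.
-- Its points are a, b, a ⊕ b.

record Line : Set where
  constructor line
  field
    a   : V5
    b   : V5
    a≢0 : a ≢ 0v
    b≢0 : b ≢ 0v
    a≢b : a ≢ b
open Line public

onLine : V5 → Line → Bool
onLine p L = (p == a L) ∨ (p == b L) ∨ (p == (a L ⊕ b L))

SameLine : Line → Line → Set
SameLine L M = ∀ p → onLine p L ≡ onLine p M

Distinct : {n : ℕ} → Vec Line n → Set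
Distinct {n} Ls = (i j : Fin n) → i ≢ j → ¬ SameLine (lookup Ls i) (lookup Ls j)

record Plane : Set where
  constructor plane
  field
    u₁ u₂ u₃ : V5
    indep : ∀ x y z → (x · u₁) ⊕ ((y · u₂) ⊕ (z · u₃)) ≡ 0v →
            (x ≡ false) × (y ≡ false) × (z ≡ false)
open Plane public

_∈P_ : V5 → Plane → Set
p ∈P E = ∃[ x ] ∃[ y ] ∃[ z ] p ≡ (x · u₁ E) ⊕ ((y · u₂ E) ⊕ (z · u₃ E))

-- Hyperplanes: kernels of nonzero functionals η; here membership.
_∈H_ : V5 → V5 → Set
p ∈H η = dot η p ≡ false

LineInPlane : Line → Plane → Set
LineInPlane L E = ∀ p → onLine p L ≡ true → p ∈P E

PlaneInHyperplane : Plane → V5 → Set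
PlaneInHyperplane E η = ∀ p → p ∈P E → p ∈H η

count : {A : Set} → (A → Bool) → List A → ℕ
count P []       = 0
count P (x ∷ xs) = if P x then suc (count P xs) else count P xs

linesThrough : {n : ℕ} → V5 → Vec Line n → ℕ
linesThrough p Ls = count (onLine p) (toList Ls)

-- The additive code associated with a multiset (list) of lines.
-- The codeword of the functional f is ((f(a₁),f(b₁)),…,(f(aₙ),f(bₙ))).

codeword : List Line → V5 → List (Bool × Bool)
codeword Ls f = map (λ L → (dot f (a L) , dot f (b L))) Ls

weight : List (Bool × Bool) → ℕ
weight = count (λ { (x , y) → x ∨ y })

multisetC : ℕ → ℕ → ℕ → ℕ → Line → Vec Line 6 → Vec Line 8 → Vec Line 8 → List Line
multisetC g h v e l₀ Os Vs Es =
  Data.List.replicate g l₀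
  ++ concat (map (Data.List.replicate h) (toList Os))
  ++ concat (map (Data.List.replicate v) (toList Vs))
  ++ concat (map (Data.List.replicate e) (toList Es))

-- The weight of the codeword of a functional f is g·[l₀ ⊄ ker f] + h·#{other lines of E₀ ⊄ ker f}
-- + v·#{lines of 𝒱 ⊄ ker f} + e·#{lines of ℰ ⊄ ker f}. Counting the points of the solid ker f with
-- their multiplicities in a family of lines, a line inside ker f contributes 3 and any other line 1,
-- so the number of lines of 𝒱 or ℰ inside ker f is read off from these multiplicities, which the
-- hypotheses determine (for 𝒱 they vanish on H₀ ∖ E₀, as the total must be 3·8). The outcome only
-- depends on the position of ker f: ker f = H₀; E₀ ⊂ ker f ≠ H₀; ker f ∩ E₀ = l₀; or ker f ∩ E₀ is
-- another line of E₀. In coordinates E₀ ≅ F₂³ the seven lines of E₀ are the kernels of the seven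
-- nonzero functionals on F₂³, and a line of E₀ lies in ker f exactly when the restriction of f to
-- E₀ is 0 or that functional. Every case occurs because restriction to E₀ is onto; the minimum
-- distance and the injectivity of f ↦ codeword follow from the four weights.

module Submission where

open import Defs
open import Data.Bool using (Bool; true; false)
open import Data.Nat using (ℕ; _+_; _*_; _≤_; _<_; _⊓_)
open import Data.List using (List; length)
open import Data.Vec using (Vec; lookup)
open import Data.Fin using (Fin)
open import Data.Product using (_×_; ∃-syntax)
open import Data.Sum using (_⊎_)
open import Relation.Nullary using (¬_)
open import Relation.Binary.PropositionalEquality using (_≡_; _≢_)

open import Algebra.Bundles using (CommutativeRing)
open import Data.Bool using (not; _∧_; _∨_; _xor_)
open import Data.Bool.Properties
  using (xor-assoc; xor-comm; xor-identityˡ; xor-identityʳ; xor-same; ∧-distribˡ-xor; ∧-comm;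
         ∧-conicalˡ; ∧-conicalʳ; ∨-zeroʳ; not-involutive; not-injective; xor-∧-commutativeRing)
  renaming (_≟_ to _≟B_)
open import Data.Fin using (zero; suc)
import Data.Fin.Properties as Fin
open import Data.List using ([]; _∷_; _++_; map; replicate; concat; allFin)
open import Data.List.Membership.Propositional using (_∈_; lose)
open import Data.List.Membership.Propositional.Properties using (∈-++⁺ˡ; ∈-++⁺ʳ; ∈-map⁺)
open import Data.List.Properties using (map-++; length-++; length-map; length-tabulate; map-tabulate; ∷-injective)
import Data.List as List
import Data.List.Relation.Unary.All as All
import Data.List.Relation.Unary.Any as Any
open import Data.List.Relation.Unary.Any using (here; there)
open import Data.Nat using (zero; suc; _^_; z≤n; s≤s)
open import Data.Nat.ListAction using (sum)
open import Data.Nat.ListAction.Properties using (sum-++)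
open import Data.Nat.Properties
  using (+-assoc; +-comm; +-suc; +-identityʳ; +-cancelˡ-≡; +-cancelʳ-≡; +-mono-≤; +-monoˡ-≤; +-monoʳ-≤;
         +-cancelˡ-≤; +-cancelʳ-≤; *-comm; *-identityˡ; *-identityʳ; *-zeroʳ; *-distribˡ-+;
         *-cancelˡ-≡; *-monoʳ-≤; ≤-antisym; ≤-reflexive; ≤-trans; m≤m+n; n≮0; m⊓n≤m; m⊓n≤n; ⊓-sel;
         +-commutativeSemigroup; *-commutativeSemigroup; module ≤-Reasoning)
  renaming (_≟_ to _≟ℕ_)
open import Data.Nat.Tactic.RingSolver using (solve)
open import Data.Product using (_,_; proj₁; proj₂; map₂)
open import Data.Sum using (inj₁; inj₂)
open import Data.Vec using ([]; _∷_; toList; zipWith)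
import Data.Vec as Vec
open import Data.Vec.Properties using (≡-dec; zipWith-assoc; zipWith-comm; zipWith-identityˡ; zipWith-identityʳ; length-toList)
open import Function using (_∘_; id)
open import Relation.Nullary using (Dec; does; yes; no; contradiction)
open import Relation.Nullary.Decidable using (dec-true; dec-false; map′; from-yes; ¬?; _×-dec_; _→-dec_; decidable-stable)
open import Relation.Unary using (Decidable)
open import Relation.Binary.PropositionalEquality using (refl; sym; trans; cong; cong₂; subst; module ≡-Reasoning)
open import Algebra.Properties.CommutativeSemigroup +-commutativeSemigroup
  using () renaming (interchange to +-interchange)
open import Algebra.Properties.CommutativeSemigroup *-commutativeSemigroup
  using () renaming (x∙yz≈y∙xz to x*yz≡y*xz)
open import Algebra.Properties.CommutativeSemigroup
  (CommutativeRing.+-commutativeSemigroup xor-∧-commutativeRing)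
  using () renaming (interchange to xor-interchange)

-- Finite sums and counting

𝟙 : Bool → ℕ
𝟙 true  = 1
𝟙 false = 0

𝟙-not : ∀ b → 𝟙 b + 𝟙 (not b) ≡ 1
𝟙-not true  = refl
𝟙-not false = refl

𝟙-split₃ : ∀ {x y z} → (y ≡ true → x ≡ true) → (z ≡ true → x ≡ true × y ≡ false) →
           𝟙 x ≡ 𝟙 (x ∧ not y ∧ not z) + 𝟙 y + 𝟙 z
𝟙-split₃ {true}  {true}  {true}  _  z⇒ = contradiction (proj₂ (z⇒ refl)) λ ()
𝟙-split₃ {true}  {true}  {false} _  _  = refl
𝟙-split₃ {true}  {false} {true}  _  _  = refl
𝟙-split₃ {true}  {false} {false} _  _  = refl
𝟙-split₃ {false} {true}  {_}     y⇒ _  = contradiction (y⇒ refl) λ ()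
𝟙-split₃ {false} {false} {true}  _  z⇒ = contradiction (proj₁ (z⇒ refl)) λ ()
𝟙-split₃ {false} {false} {false} _  _  = refl

*-distribˡ-+₃ : ∀ q x y z → q * (x + y + z) ≡ q * x + q * y + q * z
*-distribˡ-+₃ q x y z = trans (*-distribˡ-+ q (x + y) z) (cong (_+ q * z) (*-distribˡ-+ q x y))

∑ : {A : Set} → List A → (A → ℕ) → ℕ
∑ xs f = sum (map f xs)

infix 5 ∑
syntax ∑ xs (λ x → e) = ∑[ x ← xs ] e

module _ {A : Set} where

  ∑-cong : (xs : List A) {f g : A → ℕ} → (∀ x → f x ≡ g x) → ∑ xs f ≡ ∑ xs g
  ∑-cong []       f≗g = refl
  ∑-cong (x ∷ xs) f≗g = cong₂ _+_ (f≗g x) (∑-cong xs f≗g)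

  ∑-distrib-+ : (xs : List A) (f g : A → ℕ) → ∑[ x ← xs ] (f x + g x) ≡ ∑ xs f + ∑ xs g
  ∑-distrib-+ []       f g = refl
  ∑-distrib-+ (x ∷ xs) f g =
    trans (cong (f x + g x +_) (∑-distrib-+ xs f g)) (+-interchange (f x) (g x) (∑ xs f) (∑ xs g))

  ∑-*ˡ : (xs : List A) (k : ℕ) (f : A → ℕ) → ∑[ x ← xs ] (k * f x) ≡ k * ∑ xs f
  ∑-*ˡ []       k f = sym (*-zeroʳ k)
  ∑-*ˡ (x ∷ xs) k f = trans (cong (k * f x +_) (∑-*ˡ xs k f)) (sym (*-distribˡ-+ k (f x) (∑ xs f)))

  ∑-const : (xs : List A) (k : ℕ) → ∑[ x ← xs ] k ≡ length xs * k
  ∑-const []       k = refl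
  ∑-const (x ∷ xs) k = cong (k +_) (∑-const xs k)

  ∑-zero : (xs : List A) → ∑[ x ← xs ] 0 ≡ 0
  ∑-zero xs = trans (∑-const xs 0) (*-zeroʳ (length xs))

  ∑-++ : (xs ys : List A) (f : A → ℕ) → ∑ (xs ++ ys) f ≡ ∑ xs f + ∑ ys f
  ∑-++ xs ys f = trans (cong sum (map-++ f xs ys)) (sum-++ (map f xs) (map f ys))

  ∑-map : {B : Set} (g : B → A) (xs : List B) (f : A → ℕ) → ∑ (map g xs) f ≡ ∑ xs (f ∘ g)
  ∑-map g []       f = refl
  ∑-map g (x ∷ xs) f = cong (f (g x) +_) (∑-map g xs f)

  ∑-replicate : (n : ℕ) (x : A) (f : A → ℕ) → ∑ (replicate n x) f ≡ n * f x
  ∑-replicate zero    x f = refl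
  ∑-replicate (suc n) x f = cong (f x +_) (∑-replicate n x f)

  ∑-concat-replicate : (n : ℕ) (xs : List A) (f : A → ℕ) → ∑ (concat (map (replicate n) xs)) f ≡ n * ∑ xs f
  ∑-concat-replicate n []       f = sym (*-zeroʳ n)
  ∑-concat-replicate n (x ∷ xs) f = begin
    ∑ (replicate n x ++ concat (map (replicate n) xs)) f ≡⟨ ∑-++ (replicate n x) _ f ⟩
    ∑ (replicate n x) f + ∑ (concat (map (replicate n) xs)) f ≡⟨ cong₂ _+_ (∑-replicate n x f) (∑-concat-replicate n xs f) ⟩
    n * f x + n * ∑ xs f                                 ≡⟨ *-distribˡ-+ n (f x) (∑ xs f) ⟨
    n * (f x + ∑ xs f)                                   ∎
    where open ≡-Reasoning

  ∑-mono-≤ : (xs : List A) {f g : A → ℕ} → (∀ x → f x ≤ g x) → ∑ xs f ≤ ∑ xs g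
  ∑-mono-≤ []       f≤g = z≤n
  ∑-mono-≤ (x ∷ xs) f≤g = +-mono-≤ (f≤g x) (∑-mono-≤ xs f≤g)

  ∑-tight : (xs : List A) {f g : A → ℕ} → (∀ x → f x ≤ g x) → ∑ xs f ≡ ∑ xs g →
            ∀ {x} → x ∈ xs → f x ≡ g x
  ∑-tight (y ∷ xs) {f} {g} f≤g eq (here refl) =
    ≤-antisym (f≤g y) (+-cancelʳ-≤ _ (g y) (f y) (begin
      g y + ∑ xs f ≤⟨ +-monoʳ-≤ (g y) (∑-mono-≤ xs f≤g) ⟩
      g y + ∑ xs g ≡⟨ sym eq ⟩
      f y + ∑ xs f ∎))
    where open ≤-Reasoning
  ∑-tight (y ∷ xs) {f} {g} f≤g eq (there x∈xs) =
    ∑-tight xs f≤g (≤-antisym (∑-mono-≤ xs f≤g) (+-cancelˡ-≤ (f y) _ _ (begin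
      f y + ∑ xs g ≤⟨ +-monoˡ-≤ (∑ xs g) (f≤g y) ⟩
      g y + ∑ xs g ≡⟨ sym eq ⟩
      f y + ∑ xs f ∎))) x∈xs
    where open ≤-Reasoning

  ∑-𝟙-positive⇒∃ : (xs : List A) (P : A → Bool) → 0 < ∑[ x ← xs ] 𝟙 (P x) → ∃[ x ] P x ≡ true
  ∑-𝟙-positive⇒∃ (x ∷ xs) P pos with P x in Px
  ... | true  = x , Px
  ... | false = ∑-𝟙-positive⇒∃ xs P pos

  count≡∑ : (P : A → Bool) (xs : List A) → count P xs ≡ ∑[ x ← xs ] 𝟙 (P x)
  count≡∑ P []       = refl
  count≡∑ P (x ∷ xs) with P x
  ... | true  = cong suc (count≡∑ P xs)
  ... | false = count≡∑ P xs

  count-complement : (P : A → Bool) (xs : List A) → count P xs + count (not ∘ P) xs ≡ length xs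
  count-complement P []       = refl
  count-complement P (x ∷ xs) with P x
  ... | true  = cong suc (count-complement P xs)
  ... | false = trans (+-suc (count P xs) _) (cong suc (count-complement P xs))

  ∑-𝟙-complement : (xs : List A) (P : A → Bool) →
                   (∑[ x ← xs ] 𝟙 (P x)) + (∑[ x ← xs ] 𝟙 (not (P x))) ≡ length xs
  ∑-𝟙-complement xs P =
    trans (sym (cong₂ _+_ (count≡∑ P xs) (count≡∑ (not ∘ P) xs))) (count-complement P xs)

  count-map : {B : Set} (P : B → Bool) (F : A → B) (xs : List A) → count P (map F xs) ≡ count (P ∘ F) xs
  count-map P F []       = refl
  count-map P F (x ∷ xs) with P (F x)
  ... | true  = cong suc (count-map P F xs)
  ... | false = count-map P F xs

  length≡count-true : (xs : List A) → length xs ≡ count (λ _ → true) xs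
  length≡count-true []       = refl
  length≡count-true (x ∷ xs) = cong suc (length≡count-true xs)

∑-swap : {A B : Set} (xs : List A) (ys : List B) (F : A → B → ℕ) →
         ∑[ x ← xs ] ∑[ y ← ys ] F x y ≡ ∑[ y ← ys ] ∑[ x ← xs ] F x y
∑-swap []       ys F = sym (∑-zero ys)
∑-swap (x ∷ xs) ys F = trans (cong (∑ ys (F x) +_) (∑-swap xs ys F))
                             (sym (∑-distrib-+ ys (F x) (λ y → ∑[ x′ ← xs ] F x′ y)))

-- The vector space F₂ⁿ

private variable n : ℕ

infixl 6 _⊕ᵥ_

_⊕ᵥ_ : Vec Bool n → Vec Bool n → Vec Bool n
_⊕ᵥ_ = zipWith _xor_

0ᵥ : Vec Bool n
0ᵥ = Vec.replicate _ false

⟨_,_⟩ : Vec Bool n → Vec Bool n → Bool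
⟨ f , x ⟩ = Vec.foldr _ _xor_ false (zipWith _∧_ f x)

_≟ᵥ_ : (u w : Vec Bool n) → Dec (u ≡ w)
_≟ᵥ_ = ≡-dec _≟B_

_==ᵥ_ : Vec Bool n → Vec Bool n → Bool
u ==ᵥ w = does (u ≟ᵥ w)

does-true : {A : Set} (a? : Dec A) → does a? ≡ true → A
does-true (yes a) _ = a

does-false : {A : Set} (a? : Dec A) → does a? ≡ false → ¬ A
does-false (no ¬a) _ = ¬a

==ᵥ⇒≡ : (u w : Vec Bool n) → u ==ᵥ w ≡ true → u ≡ w
==ᵥ⇒≡ u w = does-true (u ≟ᵥ w)

==ᵥ-false⇒≢ : (u w : Vec Bool n) → u ==ᵥ w ≡ false → u ≢ w
==ᵥ-false⇒≢ u w = does-false (u ≟ᵥ w)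

==ᵥ-refl : (u : Vec Bool n) → u ==ᵥ u ≡ true
==ᵥ-refl u = dec-true (u ≟ᵥ u) refl

≢⇒==ᵥ-false : {u w : Vec Bool n} → u ≢ w → u ==ᵥ w ≡ false
≢⇒==ᵥ-false {u = u} {w} = dec-false (u ≟ᵥ w)

==ᵥ-sym : (u w : Vec Bool n) → (u ==ᵥ w) ≡ (w ==ᵥ u)
==ᵥ-sym u w with u ≟ᵥ w
... | yes refl = sym (==ᵥ-refl u)
... | no u≢w   = sym (≢⇒==ᵥ-false (u≢w ∘ sym))

⊕ᵥ-assoc : (u v w : Vec Bool n) → u ⊕ᵥ v ⊕ᵥ w ≡ u ⊕ᵥ (v ⊕ᵥ w)
⊕ᵥ-assoc = zipWith-assoc xor-assoc

⊕ᵥ-comm : (u w : Vec Bool n) → u ⊕ᵥ w ≡ w ⊕ᵥ u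
⊕ᵥ-comm = zipWith-comm xor-comm

⊕ᵥ-identityˡ : (u : Vec Bool n) → 0ᵥ ⊕ᵥ u ≡ u
⊕ᵥ-identityˡ = zipWith-identityˡ xor-identityˡ

⊕ᵥ-identityʳ : (u : Vec Bool n) → u ⊕ᵥ 0ᵥ ≡ u
⊕ᵥ-identityʳ = zipWith-identityʳ xor-identityʳ

⊕ᵥ-self : (u : Vec Bool n) → u ⊕ᵥ u ≡ 0ᵥ
⊕ᵥ-self []      = refl
⊕ᵥ-self (x ∷ u) = cong₂ _∷_ (xor-same x) (⊕ᵥ-self u)

⊕ᵥ-interchange : (u v w z : Vec Bool n) → (u ⊕ᵥ v) ⊕ᵥ (w ⊕ᵥ z) ≡ (u ⊕ᵥ w) ⊕ᵥ (v ⊕ᵥ z)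
⊕ᵥ-interchange []      []      []      []      = refl
⊕ᵥ-interchange (a ∷ u) (b ∷ v) (c ∷ w) (d ∷ z) = cong₂ _∷_ (xor-interchange a b c d) (⊕ᵥ-interchange u v w z)

⊕ᵥ-cancelˡ : (u w : Vec Bool n) → u ⊕ᵥ (u ⊕ᵥ w) ≡ w
⊕ᵥ-cancelˡ u w = begin
  u ⊕ᵥ (u ⊕ᵥ w) ≡⟨ ⊕ᵥ-assoc u u w ⟨
  u ⊕ᵥ u ⊕ᵥ w   ≡⟨ cong (_⊕ᵥ w) (⊕ᵥ-self u) ⟩
  0ᵥ ⊕ᵥ w       ≡⟨ ⊕ᵥ-identityˡ w ⟩
  w             ∎
  where open ≡-Reasoning

⊕ᵥ≡0⇒≡ : (u w : Vec Bool n) → u ⊕ᵥ w ≡ 0ᵥ → u ≡ w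
⊕ᵥ≡0⇒≡ u w eq = begin
  u             ≡⟨ ⊕ᵥ-identityʳ u ⟨
  u ⊕ᵥ 0ᵥ       ≡⟨ cong (u ⊕ᵥ_) eq ⟨
  u ⊕ᵥ (u ⊕ᵥ w) ≡⟨ ⊕ᵥ-cancelˡ u w ⟩
  w             ∎
  where open ≡-Reasoning

x⊕ᵥy≡x⇒y≡0 : (u w : Vec Bool n) → u ⊕ᵥ w ≡ u → w ≡ 0ᵥ
x⊕ᵥy≡x⇒y≡0 u w eq = trans (sym (⊕ᵥ-cancelˡ u w)) (trans (cong (u ⊕ᵥ_) eq) (⊕ᵥ-self u))

⟨⟩-distribʳ-⊕ : (f u w : Vec Bool n) → ⟨ f , u ⊕ᵥ w ⟩ ≡ ⟨ f , u ⟩ xor ⟨ f , w ⟩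
⟨⟩-distribʳ-⊕ []      []      []      = refl
⟨⟩-distribʳ-⊕ (a ∷ f) (b ∷ u) (c ∷ w) = begin
  (a ∧ (b xor c)) xor ⟨ f , u ⊕ᵥ w ⟩                 ≡⟨ cong₂ _xor_ (∧-distribˡ-xor a b c) (⟨⟩-distribʳ-⊕ f u w) ⟩
  ((a ∧ b) xor (a ∧ c)) xor (⟨ f , u ⟩ xor ⟨ f , w ⟩) ≡⟨ xor-interchange (a ∧ b) (a ∧ c) _ _ ⟩
  ((a ∧ b) xor ⟨ f , u ⟩) xor ((a ∧ c) xor ⟨ f , w ⟩) ∎
  where open ≡-Reasoning

⟨⟩-comm : (f x : Vec Bool n) → ⟨ f , x ⟩ ≡ ⟨ x , f ⟩
⟨⟩-comm []      []      = refl
⟨⟩-comm (a ∷ f) (b ∷ x) = cong₂ _xor_ (∧-comm a b) (⟨⟩-comm f x)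

⟨⟩-distribˡ-⊕ : (f g u : Vec Bool n) → ⟨ f ⊕ᵥ g , u ⟩ ≡ ⟨ f , u ⟩ xor ⟨ g , u ⟩
⟨⟩-distribˡ-⊕ f g u = begin
  ⟨ f ⊕ᵥ g , u ⟩          ≡⟨ ⟨⟩-comm (f ⊕ᵥ g) u ⟩
  ⟨ u , f ⊕ᵥ g ⟩          ≡⟨ ⟨⟩-distribʳ-⊕ u f g ⟩
  ⟨ u , f ⟩ xor ⟨ u , g ⟩ ≡⟨ cong₂ _xor_ (⟨⟩-comm u f) (⟨⟩-comm u g) ⟩
  ⟨ f , u ⟩ xor ⟨ g , u ⟩ ∎
  where open ≡-Reasoning

⟨⟩-zeroˡ : (x : Vec Bool n) → ⟨ 0ᵥ , x ⟩ ≡ false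
⟨⟩-zeroˡ []      = refl
⟨⟩-zeroˡ (a ∷ x) = ⟨⟩-zeroˡ x

⟨⟩-zeroʳ : (f : Vec Bool n) → ⟨ f , 0ᵥ ⟩ ≡ false
⟨⟩-zeroʳ f = trans (⟨⟩-comm f 0ᵥ) (⟨⟩-zeroˡ f)

⟨⟩≡true⇒≢0 : (f x : Vec Bool n) → ⟨ f , x ⟩ ≡ true → x ≢ 0ᵥ
⟨⟩≡true⇒≢0 f x fx refl = contradiction (trans (sym fx) (⟨⟩-zeroʳ f)) λ ()

-- Enumerating F₂ⁿ

allVec : (n : ℕ) → List (Vec Bool n)
allVec zero    = [] ∷ []
allVec (suc n) = map (true ∷_) (allVec n) ++ map (false ∷_) (allVec n)

∈-allVec : (v : Vec Bool n) → v ∈ allVec n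
∈-allVec []                  = here refl
∈-allVec         (true  ∷ v) = ∈-++⁺ˡ (∈-map⁺ (true ∷_) (∈-allVec v))
∈-allVec {suc n} (false ∷ v) = ∈-++⁺ʳ (map (true ∷_) (allVec n)) (∈-map⁺ (false ∷_) (∈-allVec v))

length-allVec : (n : ℕ) → length (allVec n) ≡ 2 ^ n
length-allVec zero    = refl
length-allVec (suc n) = begin
  length (map (true ∷_) (allVec n) ++ map (false ∷_) (allVec n))
    ≡⟨ length-++ (map (true ∷_) (allVec n)) ⟩
  length (map (true ∷_) (allVec n)) + length (map (false ∷_) (allVec n))
    ≡⟨ cong₂ _+_ (trans (length-map _ (allVec n)) (length-allVec n)) (trans (length-map _ (allVec n)) (length-allVec n)) ⟩
  2 ^ n + 2 ^ n
    ≡⟨ cong (2 ^ n +_) (+-identityʳ (2 ^ n)) ⟨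
  2 ^ suc n ∎
  where open ≡-Reasoning

∑-allVec-suc : (f : Vec Bool (suc n) → ℕ) →
               ∑ (allVec (suc n)) f ≡ (∑[ v ← allVec n ] f (true ∷ v)) + (∑[ v ← allVec n ] f (false ∷ v))
∑-allVec-suc {n} f = trans (∑-++ (map (true ∷_) (allVec n)) _ f)
                           (cong₂ _+_ (∑-map (true ∷_) (allVec n) f) (∑-map (false ∷_) (allVec n) f))

∑-δ : (c : Vec Bool n) (Q : Vec Bool n → ℕ) → ∑[ p ← allVec n ] 𝟙 (p ==ᵥ c) * Q p ≡ Q c
∑-δ []      Q = trans (+-identityʳ (Q [] + 0)) (+-identityʳ (Q []))
∑-δ {suc n} (true  ∷ c) Q = begin
  ∑[ p ← allVec (suc n) ] 𝟙 (p ==ᵥ (true ∷ c)) * Q p  ≡⟨ ∑-allVec-suc (λ p → 𝟙 (p ==ᵥ (true ∷ c)) * Q p) ⟩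
  (∑[ p ← allVec n ] 𝟙 (p ==ᵥ c) * Q (true ∷ p)) + (∑[ p ← allVec n ] 0)
    ≡⟨ cong₂ _+_ (∑-δ c (Q ∘ (true ∷_))) (∑-zero (allVec n)) ⟩
  Q (true ∷ c) + 0                                    ≡⟨ +-identityʳ _ ⟩
  Q (true ∷ c)                                        ∎
  where open ≡-Reasoning
∑-δ {suc n} (false ∷ c) Q = begin
  ∑[ p ← allVec (suc n) ] 𝟙 (p ==ᵥ (false ∷ c)) * Q p ≡⟨ ∑-allVec-suc (λ p → 𝟙 (p ==ᵥ (false ∷ c)) * Q p) ⟩
  (∑[ p ← allVec n ] 0) + (∑[ p ← allVec n ] 𝟙 (p ==ᵥ c) * Q (false ∷ p))
    ≡⟨ cong₂ _+_ (∑-zero (allVec n)) (∑-δ c (Q ∘ (false ∷_))) ⟩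
  Q (false ∷ c)                                       ∎
  where open ≡-Reasoning

∑-δʳ : (c : Vec Bool n) (Q : Vec Bool n → ℕ) → ∑[ p ← allVec n ] Q p * 𝟙 (p ==ᵥ c) ≡ Q c
∑-δʳ {n} c Q = trans (∑-cong (allVec n) (λ p → *-comm (Q p) (𝟙 (p ==ᵥ c)))) (∑-δ c Q)

∑-𝟙-δ : (c : Vec Bool n) → ∑[ p ← allVec n ] 𝟙 (p ==ᵥ c) ≡ 1
∑-𝟙-δ {n} c = trans (∑-cong (allVec n) (λ p → sym (*-identityʳ (𝟙 (p ==ᵥ c))))) (∑-δ c (λ _ → 1))

∀? : {P : Vec Bool n → Set} → Decidable P → Dec (∀ v → P v)
∀? {n} P? = map′ (λ all v → All.lookup all (∈-allVec v)) (λ ∀P → All.tabulate (λ {v} _ → ∀P v))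
                 (All.all? P? (allVec n))

∃? : {P : Vec Bool n → Set} → Decidable P → Dec (∃[ v ] P v)
∃? {n} P? = map′ Any.satisfied (λ (v , Pv) → lose (∈-allVec v) Pv) (Any.any? P? (allVec n))

-- Kernels of linear functionals

kernel-size : (f : Vec Bool (suc n)) → f ≢ 0ᵥ → ∑[ p ← allVec (suc n) ] 𝟙 (not ⟨ f , p ⟩) ≡ 2 ^ n
kernel-size {n} (true ∷ f) _ = begin
  ∑[ p ← allVec (suc n) ] 𝟙 (not ⟨ true ∷ f , p ⟩)
    ≡⟨ ∑-allVec-suc (λ p → 𝟙 (not ⟨ true ∷ f , p ⟩)) ⟩
  (∑[ p ← allVec n ] 𝟙 (not (not ⟨ f , p ⟩))) + (∑[ p ← allVec n ] 𝟙 (not ⟨ f , p ⟩))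
    ≡⟨ cong (_+ (∑[ p ← allVec n ] 𝟙 (not ⟨ f , p ⟩))) (∑-cong (allVec n) (cong 𝟙 ∘ not-involutive ∘ (λ p → ⟨ f , p ⟩))) ⟩
  (∑[ p ← allVec n ] 𝟙 ⟨ f , p ⟩) + (∑[ p ← allVec n ] 𝟙 (not ⟨ f , p ⟩))
    ≡⟨ ∑-𝟙-complement (allVec n) (λ p → ⟨ f , p ⟩) ⟩
  length (allVec n)
    ≡⟨ length-allVec n ⟩
  2 ^ n ∎
  where open ≡-Reasoning
kernel-size {zero}  (false ∷ []) f≢0 = contradiction refl f≢0
kernel-size {suc n} (false ∷ f)  f≢0 = begin
  ∑[ p ← allVec (suc (suc n)) ] 𝟙 (not ⟨ false ∷ f , p ⟩)
    ≡⟨ ∑-allVec-suc (λ p → 𝟙 (not ⟨ false ∷ f , p ⟩)) ⟩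
  (∑[ p ← allVec (suc n) ] 𝟙 (not ⟨ f , p ⟩)) + (∑[ p ← allVec (suc n) ] 𝟙 (not ⟨ f , p ⟩))
    ≡⟨ cong₂ _+_ size size ⟩
  2 ^ n + 2 ^ n
    ≡⟨ cong (2 ^ n +_) (+-identityʳ (2 ^ n)) ⟨
  2 ^ suc n ∎
  where
  open ≡-Reasoning
  size : ∑[ p ← allVec (suc n) ] 𝟙 (not ⟨ f , p ⟩) ≡ 2 ^ n
  size = kernel-size f (f≢0 ∘ cong (false ∷_))

kernel-complement-size : (f : Vec Bool (suc n)) → f ≢ 0ᵥ → ∑[ p ← allVec (suc n) ] 𝟙 ⟨ f , p ⟩ ≡ 2 ^ n
kernel-complement-size {n} f f≢0 = +-cancelʳ-≡ (2 ^ n) _ (2 ^ n) (begin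
  (∑[ p ← allVec (suc n) ] 𝟙 ⟨ f , p ⟩) + 2 ^ n
    ≡⟨ cong ((∑[ p ← allVec (suc n) ] 𝟙 ⟨ f , p ⟩) +_) (kernel-size f f≢0) ⟨
  (∑[ p ← allVec (suc n) ] 𝟙 ⟨ f , p ⟩) + (∑[ p ← allVec (suc n) ] 𝟙 (not ⟨ f , p ⟩))
    ≡⟨ ∑-𝟙-complement (allVec (suc n)) (λ p → ⟨ f , p ⟩) ⟩
  length (allVec (suc n))
    ≡⟨ length-allVec (suc n) ⟩
  2 ^ suc n
    ≡⟨ cong (2 ^ n +_) (+-identityʳ (2 ^ n)) ⟩
  2 ^ n + 2 ^ n ∎)
  where open ≡-Reasoning

functionals-with-value : (w : Vec Bool (suc n)) → w ≢ 0ᵥ → (b : Bool) →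
                         ∑[ f ← allVec (suc n) ] 𝟙 (not (⟨ f , w ⟩ xor b)) ≡ 2 ^ n
functionals-with-value {n} w w≢0 false = begin
  ∑[ f ← allVec (suc n) ] 𝟙 (not (⟨ f , w ⟩ xor false))
    ≡⟨ ∑-cong (allVec (suc n)) (λ f → cong (𝟙 ∘ not) (trans (xor-identityʳ _) (⟨⟩-comm f w))) ⟩
  ∑[ f ← allVec (suc n) ] 𝟙 (not ⟨ w , f ⟩)            ≡⟨ kernel-size w w≢0 ⟩
  2 ^ n                                                 ∎
  where open ≡-Reasoning
functionals-with-value {n} w w≢0 true = begin
  ∑[ f ← allVec (suc n) ] 𝟙 (not (⟨ f , w ⟩ xor true))
    ≡⟨ ∑-cong (allVec (suc n)) (λ f → cong 𝟙 (trans (cong not (xor-comm _ true)) (trans (not-involutive _) (⟨⟩-comm f w)))) ⟩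
  ∑[ f ← allVec (suc n) ] 𝟙 ⟨ w , f ⟩                  ≡⟨ kernel-complement-size w w≢0 ⟩
  2 ^ n                                                ∎
  where open ≡-Reasoning

-- Pointwise 2[¬x][y] + [¬(x ⊕ y)] = [¬x] + [y], so this count follows from the sizes of
-- ker f, of the complement of ker η and of ker (f ⊕ η).
kernel-difference-size : (f η : Vec Bool (suc n)) → f ≢ 0ᵥ → η ≢ 0ᵥ → f ≢ η →
                         2 * (∑[ p ← allVec (suc n) ] 𝟙 (not ⟨ f , p ⟩) * 𝟙 ⟨ η , p ⟩) ≡ 2 ^ n
kernel-difference-size {n} f η f≢0 η≢0 f≢η = +-cancelʳ-≡ (2 ^ n) _ (2 ^ n) (begin
  2 * (∑[ p ← V ] 𝟙 (not ⟨ f , p ⟩) * 𝟙 ⟨ η , p ⟩) + 2 ^ n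
    ≡⟨ cong₂ _+_ (∑-*ˡ V 2 _) (kernel-size (f ⊕ᵥ η) (f≢η ∘ ⊕ᵥ≡0⇒≡ f η)) ⟨
  (∑[ p ← V ] 2 * (𝟙 (not ⟨ f , p ⟩) * 𝟙 ⟨ η , p ⟩)) + (∑[ p ← V ] 𝟙 (not ⟨ f ⊕ᵥ η , p ⟩))
    ≡⟨ ∑-distrib-+ V _ _ ⟨
  ∑[ p ← V ] (2 * (𝟙 (not ⟨ f , p ⟩) * 𝟙 ⟨ η , p ⟩) + 𝟙 (not ⟨ f ⊕ᵥ η , p ⟩))
    ≡⟨ ∑-cong V (λ p → trans (cong (λ b → 2 * (𝟙 (not ⟨ f , p ⟩) * 𝟙 ⟨ η , p ⟩) + 𝟙 (not b)) (⟨⟩-distribˡ-⊕ f η p))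
                             (split ⟨ f , p ⟩ ⟨ η , p ⟩)) ⟩
  ∑[ p ← V ] (𝟙 (not ⟨ f , p ⟩) + 𝟙 ⟨ η , p ⟩)
    ≡⟨ ∑-distrib-+ V _ _ ⟩
  (∑[ p ← V ] 𝟙 (not ⟨ f , p ⟩)) + (∑[ p ← V ] 𝟙 ⟨ η , p ⟩)
    ≡⟨ cong₂ _+_ (kernel-size f f≢0) (kernel-complement-size η η≢0) ⟩
  2 ^ n + 2 ^ n ∎)
  where
  open ≡-Reasoning
  V : List (Vec Bool (suc n))
  V = allVec (suc n)
  split : ∀ x y → 2 * (𝟙 (not x) * 𝟙 y) + 𝟙 (not (x xor y)) ≡ 𝟙 (not x) + 𝟙 y
  split false false = refl
  split false true  = refl
  split true  false = refl
  split true  true  = refl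

-- Lines of the coordinate plane F₂³

F₂³ : Set
F₂³ = Vec Bool 3

_×ᵥ_ : F₂³ → F₂³ → F₂³
(a₁ ∷ a₂ ∷ a₃ ∷ []) ×ᵥ (b₁ ∷ b₂ ∷ b₃ ∷ []) =
  ((a₂ ∧ b₃) xor (a₃ ∧ b₂)) ∷ ((a₃ ∧ b₁) xor (a₁ ∧ b₃)) ∷ ((a₁ ∧ b₂) xor (a₂ ∧ b₁)) ∷ []

Independent : F₂³ → F₂³ → Set
Independent α β = α ≢ 0ᵥ × β ≢ 0ᵥ × α ≢ β

independent? : ∀ α β → Dec (Independent α β)
independent? α β = ¬? (α ≟ᵥ 0ᵥ) ×-dec ¬? (β ≟ᵥ 0ᵥ) ×-dec ¬? (α ≟ᵥ β)

×ᵥ-nonzero : ∀ α β → Independent α β → α ×ᵥ β ≢ 0ᵥ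
×ᵥ-nonzero = from-yes (∀? λ α → ∀? λ β → independent? α β →-dec ¬? ((α ×ᵥ β) ≟ᵥ 0ᵥ))

span-points : ∀ α β x → Independent α β →
              (x ==ᵥ α ∨ x ==ᵥ β ∨ x ==ᵥ (α ⊕ᵥ β)) ≡ (not (x ==ᵥ 0ᵥ) ∧ not ⟨ α ×ᵥ β , x ⟩)
span-points = from-yes (∀? λ α → ∀? λ β → ∀? λ x → independent? α β →-dec
  ((x ==ᵥ α ∨ x ==ᵥ β ∨ x ==ᵥ (α ⊕ᵥ β)) ≟B (not (x ==ᵥ 0ᵥ) ∧ not ⟨ α ×ᵥ β , x ⟩)))

span-⊄ker : ∀ α β c → Independent α β → (⟨ c , α ⟩ ∨ ⟨ c , β ⟩) ≡ not (c ==ᵥ 0ᵥ ∨ c ==ᵥ (α ×ᵥ β))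
span-⊄ker = from-yes (∀? λ α → ∀? λ β → ∀? λ c → independent? α β →-dec
  ((⟨ c , α ⟩ ∨ ⟨ c , β ⟩) ≟B not (c ==ᵥ 0ᵥ ∨ c ==ᵥ (α ×ᵥ β))))

avoids : F₂³ → F₂³ → Bool
avoids γ c = not (c ==ᵥ 0ᵥ) ∧ not (c ==ᵥ γ)

avoids-intro : ∀ {γ c} → c ≢ 0ᵥ → c ≢ γ → avoids γ c ≡ true
avoids-intro c≢0 c≢γ = cong₂ (λ x y → not x ∧ not y) (≢⇒==ᵥ-false c≢0) (≢⇒==ᵥ-false c≢γ)

#avoids : ∀ γ → γ ≢ 0ᵥ → ∑[ c ← allVec 3 ] 𝟙 (avoids γ c) ≡ 6
#avoids = from-yes (∀? λ γ → ¬? (γ ≟ᵥ 0ᵥ) →-dec ((∑[ c ← allVec 3 ] 𝟙 (avoids γ c)) ≟ℕ 6))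

-- Lines of PG(4,2) and double counting

a≢a⊕b : (L : Line) → a L ≢ a L ⊕ b L
a≢a⊕b L eq = b≢0 L (x⊕ᵥy≡x⇒y≡0 (a L) (b L) (sym eq))

b≢a⊕b : (L : Line) → b L ≢ a L ⊕ b L
b≢a⊕b L eq = a≢0 L (x⊕ᵥy≡x⇒y≡0 (b L) (a L) (trans (⊕ᵥ-comm (b L) (a L)) (sym eq)))

onLine-a : (L : Line) → onLine (a L) L ≡ true
onLine-a L rewrite ==ᵥ-refl (a L) = refl

onLine-b : (L : Line) → onLine (b L) L ≡ true
onLine-b L rewrite ==ᵥ-refl (b L) = ∨-zeroʳ (b L == a L)

onLine-0 : ∀ L → onLine 0v L ≡ false
onLine-0 L rewrite ≢⇒==ᵥ-false (a≢0 L ∘ sym) | ≢⇒==ᵥ-false (b≢0 L ∘ sym)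
                 | ≢⇒==ᵥ-false (a≢b L ∘ ⊕ᵥ≡0⇒≡ (a L) (b L) ∘ sym) = refl

𝟙-onLine : ∀ p L → 𝟙 (onLine p L) ≡ 𝟙 (p == a L) + 𝟙 (p == b L) + 𝟙 (p == (a L ⊕ b L))
𝟙-onLine p L with p == a L in p≡a | p == b L in p≡b | p == (a L ⊕ b L) in p≡a⊕b
... | true  | true  | _     = contradiction (trans (sym (==ᵥ⇒≡ p (a L) p≡a)) (==ᵥ⇒≡ p (b L) p≡b)) (a≢b L)
... | true  | false | true  = contradiction (trans (sym (==ᵥ⇒≡ p (a L) p≡a)) (==ᵥ⇒≡ p (a L ⊕ b L) p≡a⊕b)) (a≢a⊕b L)
... | false | true  | true  = contradiction (trans (sym (==ᵥ⇒≡ p (b L) p≡b)) (==ᵥ⇒≡ p (a L ⊕ b L) p≡a⊕b)) (b≢a⊕b L)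
... | true  | false | false = refl
... | false | true  | false = refl
... | false | false | true  = refl
... | false | false | false = refl

∑-onLine : ∀ (Q : V5 → ℕ) L → ∑[ p ← allVec 5 ] Q p * 𝟙 (onLine p L) ≡ Q (a L) + Q (b L) + Q (a L ⊕ b L)
∑-onLine Q L = begin
  ∑[ p ← allVec 5 ] Q p * 𝟙 (onLine p L)
    ≡⟨ ∑-cong (allVec 5) (λ p → trans (cong (Q p *_) (𝟙-onLine p L))
                                      (*-distribˡ-+₃ (Q p) (𝟙 (p == a L)) (𝟙 (p == b L)) (𝟙 (p == (a L ⊕ b L))))) ⟩
  ∑[ p ← allVec 5 ] (δ (a L) p + δ (b L) p + δ (a L ⊕ b L) p)
    ≡⟨ ∑-distrib-+ (allVec 5) (λ p → δ (a L) p + δ (b L) p) (δ (a L ⊕ b L)) ⟩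
  (∑[ p ← allVec 5 ] (δ (a L) p + δ (b L) p)) + ∑ (allVec 5) (δ (a L ⊕ b L))
    ≡⟨ cong (_+ ∑ (allVec 5) (δ (a L ⊕ b L))) (∑-distrib-+ (allVec 5) (δ (a L)) (δ (b L))) ⟩
  ∑ (allVec 5) (δ (a L)) + ∑ (allVec 5) (δ (b L)) + ∑ (allVec 5) (δ (a L ⊕ b L))
    ≡⟨ cong₂ _+_ (cong₂ _+_ (∑-δʳ (a L) Q) (∑-δʳ (b L) Q)) (∑-δʳ (a L ⊕ b L) Q) ⟩
  Q (a L) + Q (b L) + Q (a L ⊕ b L) ∎
  where
  open ≡-Reasoning
  δ : V5 → V5 → ℕ
  δ c p = Q p * 𝟙 (p == c)

∑-incidences : ∀ (Q : V5 → ℕ) Ls →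
  ∑[ p ← allVec 5 ] Q p * count (onLine p) Ls ≡ ∑[ L ← Ls ] (Q (a L) + Q (b L) + Q (a L ⊕ b L))
∑-incidences Q Ls = begin
  ∑[ p ← allVec 5 ] Q p * count (onLine p) Ls
    ≡⟨ ∑-cong (allVec 5) (λ p → trans (cong (Q p *_) (count≡∑ (onLine p) Ls)) (sym (∑-*ˡ Ls (Q p) (λ L → 𝟙 (onLine p L))))) ⟩
  ∑[ p ← allVec 5 ] ∑[ L ← Ls ] Q p * 𝟙 (onLine p L)
    ≡⟨ ∑-swap (allVec 5) Ls (λ p L → Q p * 𝟙 (onLine p L)) ⟩
  ∑[ L ← Ls ] ∑[ p ← allVec 5 ] Q p * 𝟙 (onLine p L)
    ≡⟨ ∑-cong Ls (∑-onLine Q) ⟩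
  ∑[ L ← Ls ] (Q (a L) + Q (b L) + Q (a L ⊕ b L)) ∎
  where open ≡-Reasoning

𝟙ker : V5 → V5 → ℕ
𝟙ker f p = 𝟙 (not (dot f p))

_⊄ker_ : Line → V5 → Bool
L ⊄ker f = dot f (a L) ∨ dot f (b L)

kernel-points-on-line : ∀ f L → 𝟙ker f (a L) + 𝟙ker f (b L) + 𝟙ker f (a L ⊕ b L) ≡ 1 + 2 * 𝟙 (not (L ⊄ker f))
kernel-points-on-line f L rewrite ⟨⟩-distribʳ-⊕ f (a L) (b L) with dot f (a L) | dot f (b L)
... | true  | true  = refl
... | true  | false = refl
... | false | true  = refl
... | false | false = refl

kernel-incidences : ∀ f Ls →
  ∑[ p ← allVec 5 ] 𝟙ker f p * count (onLine p) Ls ≡ length Ls + 2 * count (λ L → not (L ⊄ker f)) Ls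
kernel-incidences f Ls = begin
  ∑[ p ← allVec 5 ] 𝟙ker f p * count (onLine p) Ls
    ≡⟨ ∑-incidences (𝟙ker f) Ls ⟩
  ∑[ L ← Ls ] (𝟙ker f (a L) + 𝟙ker f (b L) + 𝟙ker f (a L ⊕ b L))
    ≡⟨ ∑-cong Ls (kernel-points-on-line f) ⟩
  ∑[ L ← Ls ] (1 + 2 * 𝟙 (not (L ⊄ker f)))
    ≡⟨ ∑-distrib-+ Ls (λ _ → 1) (λ L → 2 * 𝟙 (not (L ⊄ker f))) ⟩
  (∑[ L ← Ls ] 1) + (∑[ L ← Ls ] 2 * 𝟙 (not (L ⊄ker f)))
    ≡⟨ cong₂ _+_ (trans (∑-const Ls 1) (*-identityʳ (length Ls))) (∑-*ˡ Ls 2 (λ L → 𝟙 (not (L ⊄ker f)))) ⟩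
  length Ls + 2 * (∑[ L ← Ls ] 𝟙 (not (L ⊄ker f)))
    ≡⟨ cong (λ k → length Ls + 2 * k) (count≡∑ _ Ls) ⟨
  length Ls + 2 * count (λ L → not (L ⊄ker f)) Ls ∎
  where open ≡-Reasoning

#⊄ker : ∀ {n} → V5 → Vec Line n → ℕ
#⊄ker f Ls = count (_⊄ker f) (toList Ls)

#⊄ker-from-incidences : ∀ {n} (Ls : Vec Line n) f k →
  ∑[ p ← allVec 5 ] 𝟙ker f p * linesThrough p Ls ≡ n + 2 * k → #⊄ker f Ls + k ≡ n
#⊄ker-from-incidences {n} Ls f k incidences = begin
  #⊄ker f Ls + k                                                ≡⟨ cong (#⊄ker f Ls +_) #⊆ker≡k ⟨
  #⊄ker f Ls + count (not ∘ (_⊄ker f)) (toList Ls)              ≡⟨ count-complement (_⊄ker f) (toList Ls) ⟩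
  length (toList Ls)                                            ≡⟨ length-toList Ls ⟩
  n                                                             ∎
  where
  open ≡-Reasoning
  #⊆ker≡k : count (not ∘ (_⊄ker f)) (toList Ls) ≡ k
  #⊆ker≡k = *-cancelˡ-≡ _ k 2 (+-cancelˡ-≡ n _ _ (begin
    n + 2 * count (not ∘ (_⊄ker f)) (toList Ls)                  ≡⟨ cong (_+ 2 * count (not ∘ (_⊄ker f)) (toList Ls)) (length-toList Ls) ⟨
    length (toList Ls) + 2 * count (not ∘ (_⊄ker f)) (toList Ls) ≡⟨ kernel-incidences f (toList Ls) ⟨
    ∑[ p ← allVec 5 ] 𝟙ker f p * linesThrough p Ls              ≡⟨ incidences ⟩
    n + 2 * k                                                    ∎))

∑-linesThrough : ∀ {n} (Ls : Vec Line n) → ∑[ p ← allVec 5 ] linesThrough p Ls ≡ n * 3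
∑-linesThrough {n} Ls = begin
  ∑[ p ← allVec 5 ] linesThrough p Ls       ≡⟨ ∑-cong (allVec 5) (λ p → sym (*-identityˡ (linesThrough p Ls))) ⟩
  ∑[ p ← allVec 5 ] 1 * linesThrough p Ls   ≡⟨ ∑-incidences (λ _ → 1) (toList Ls) ⟩
  ∑[ L ← toList Ls ] 3                      ≡⟨ ∑-const (toList Ls) 3 ⟩
  length (toList Ls) * 3                    ≡⟨ cong (_* 3) (length-toList Ls) ⟩
  n * 3                                     ∎
  where open ≡-Reasoning

-- Coordinates on a plane

·-⊕ : ∀ x y u → (x · u) ⊕ (y · u) ≡ (x xor y) · u
·-⊕ true  true  u = ⊕ᵥ-self u
·-⊕ true  false u = ⊕ᵥ-identityʳ u
·-⊕ false true  u = ⊕ᵥ-identityˡ u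
·-⊕ false false u = refl

dot-· : ∀ f x u → dot f (x · u) ≡ x ∧ dot f u
dot-· f true  u = refl
dot-· f false u = ⟨⟩-zeroʳ f

module PlaneCoordinates (E : Plane) where

  param : F₂³ → V5
  param (x ∷ y ∷ z ∷ []) = (x · u₁ E) ⊕ ((y · u₂ E) ⊕ (z · u₃ E))

  restrict : V5 → F₂³
  restrict f = dot f (u₁ E) ∷ dot f (u₂ E) ∷ dot f (u₃ E) ∷ []

  param-⊕ : ∀ s t → param s ⊕ param t ≡ param (s ⊕ᵥ t)
  param-⊕ (x ∷ y ∷ z ∷ []) (x′ ∷ y′ ∷ z′ ∷ []) = begin
    (X ⊕ (Y ⊕ Z)) ⊕ (X′ ⊕ (Y′ ⊕ Z′))   ≡⟨ ⊕ᵥ-interchange X (Y ⊕ Z) X′ (Y′ ⊕ Z′) ⟩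
    (X ⊕ X′) ⊕ ((Y ⊕ Z) ⊕ (Y′ ⊕ Z′))   ≡⟨ cong ((X ⊕ X′) ⊕_) (⊕ᵥ-interchange Y Z Y′ Z′) ⟩
    (X ⊕ X′) ⊕ ((Y ⊕ Y′) ⊕ (Z ⊕ Z′))   ≡⟨ cong₂ _⊕_ (·-⊕ x x′ (u₁ E)) (cong₂ _⊕_ (·-⊕ y y′ (u₂ E)) (·-⊕ z z′ (u₃ E))) ⟩
    param ((x ∷ y ∷ z ∷ []) ⊕ᵥ (x′ ∷ y′ ∷ z′ ∷ [])) ∎
    where
    open ≡-Reasoning
    X Y Z X′ Y′ Z′ : V5
    X = x · u₁ E ; Y = y · u₂ E ; Z = z · u₃ E
    X′ = x′ · u₁ E ; Y′ = y′ · u₂ E ; Z′ = z′ · u₃ E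

  param≡0⇒≡0 : ∀ t → param t ≡ 0v → t ≡ 0ᵥ
  param≡0⇒≡0 (x ∷ y ∷ z ∷ []) eq with indep E x y z eq
  ... | refl , refl , refl = refl

  param-injective : ∀ s t → param s ≡ param t → s ≡ t
  param-injective s t eq = ⊕ᵥ≡0⇒≡ s t (param≡0⇒≡0 (s ⊕ᵥ t) (begin
    param (s ⊕ᵥ t)        ≡⟨ param-⊕ s t ⟨
    param s ⊕ param t     ≡⟨ cong (param s ⊕_) eq ⟨
    param s ⊕ param s     ≡⟨ ⊕ᵥ-self (param s) ⟩
    0v                    ∎))
    where open ≡-Reasoning

  dot-param : ∀ f t → dot f (param t) ≡ ⟨ restrict f , t ⟩
  dot-param f (x ∷ y ∷ z ∷ []) = begin
    dot f ((x · u₁ E) ⊕ ((y · u₂ E) ⊕ (z · u₃ E)))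
      ≡⟨ ⟨⟩-distribʳ-⊕ f (x · u₁ E) _ ⟩
    dot f (x · u₁ E) xor dot f ((y · u₂ E) ⊕ (z · u₃ E))
      ≡⟨ cong (dot f (x · u₁ E) xor_) (⟨⟩-distribʳ-⊕ f (y · u₂ E) (z · u₃ E)) ⟩
    dot f (x · u₁ E) xor (dot f (y · u₂ E) xor dot f (z · u₃ E))
      ≡⟨ cong₂ _xor_ (dot-· f x (u₁ E)) (cong₂ _xor_ (dot-· f y (u₂ E)) (dot-· f z (u₃ E))) ⟩
    (x ∧ dot f (u₁ E)) xor ((y ∧ dot f (u₂ E)) xor (z ∧ dot f (u₃ E)))
      ≡⟨ cong (λ w → (x ∧ dot f (u₁ E)) xor ((y ∧ dot f (u₂ E)) xor w)) (xor-identityʳ _) ⟨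
    ⟨ x ∷ y ∷ z ∷ [] , restrict f ⟩
      ≡⟨ ⟨⟩-comm (x ∷ y ∷ z ∷ []) (restrict f) ⟩
    ⟨ restrict f , x ∷ y ∷ z ∷ [] ⟩ ∎
    where open ≡-Reasoning

  _∈E? : (p : V5) → Dec (p ∈P E)
  p ∈E? = map′ (λ { (x ∷ y ∷ z ∷ [] , eq) → x , y , z , eq }) (λ (x , y , z , eq) → x ∷ y ∷ z ∷ [] , eq)
               (∃? (λ t → p ≟ᵥ param t))

  inE : V5 → Bool
  inE p = does (p ∈E?)

  inE⇒∈ : ∀ {p} → inE p ≡ true → p ∈P E
  inE⇒∈ {p} = does-true (p ∈E?)

  inE⇒∉ : ∀ {p} → inE p ≡ false → ¬ (p ∈P E)
  inE⇒∉ {p} = does-false (p ∈E?)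

  ∈⇒inE : ∀ {p} → p ∈P E → inE p ≡ true
  ∈⇒inE {p} = dec-true (p ∈E?)

  ==-param : ∀ s t → (param s == param t) ≡ (s ==ᵥ t)
  ==-param s t with s ≟ᵥ t
  ... | yes refl = ==ᵥ-refl (param t)
  ... | no s≢t   = ≢⇒==ᵥ-false (s≢t ∘ param-injective s t)

  #coordinates : ∀ p → ∑[ t ← allVec 3 ] 𝟙 (p == param t) ≡ 𝟙 (inE p)
  #coordinates p = by-decision (p ∈E?)
    where
    by-decision : (p∈E? : Dec (p ∈P E)) → ∑[ t ← allVec 3 ] 𝟙 (p == param t) ≡ 𝟙 (does p∈E?)
    by-decision (yes (x , y , z , refl)) = begin
      ∑[ t ← allVec 3 ] 𝟙 (param s == param t)
        ≡⟨ ∑-cong (allVec 3) (λ t → trans (cong 𝟙 (trans (==-param s t) (==ᵥ-sym s t))) (sym (*-identityʳ _))) ⟩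
      ∑[ t ← allVec 3 ] 𝟙 (t ==ᵥ s) * 1
        ≡⟨ ∑-δ s (λ _ → 1) ⟩
      1 ∎
      where
      open ≡-Reasoning
      s : F₂³
      s = x ∷ y ∷ z ∷ []
    by-decision (no p∉E) = trans (∑-cong (allVec 3) (λ t → cong 𝟙 (≢⇒==ᵥ-false (p≢param t)))) (∑-zero (allVec 3))
      where
      p≢param : ∀ t → p ≢ param t
      p≢param (x ∷ y ∷ z ∷ []) eq = p∉E (x , y , z , eq)

  ∑-plane : (Q : V5 → ℕ) → ∑[ p ← allVec 5 ] Q p * 𝟙 (inE p) ≡ ∑[ t ← allVec 3 ] Q (param t)
  ∑-plane Q = begin
    ∑[ p ← allVec 5 ] Q p * 𝟙 (inE p)
      ≡⟨ ∑-cong (allVec 5) (λ p → trans (cong (Q p *_) (sym (#coordinates p))) (sym (∑-*ˡ (allVec 3) (Q p) (λ t → 𝟙 (p == param t))))) ⟩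
    ∑[ p ← allVec 5 ] ∑[ t ← allVec 3 ] Q p * 𝟙 (p == param t)
      ≡⟨ ∑-swap (allVec 5) (allVec 3) (λ p t → Q p * 𝟙 (p == param t)) ⟩
    ∑[ t ← allVec 3 ] ∑[ p ← allVec 5 ] Q p * 𝟙 (p == param t)
      ≡⟨ ∑-cong (allVec 3) (λ t → trans (∑-cong (allVec 5) (λ p → *-comm (Q p) (𝟙 (p == param t)))) (∑-δ (param t) Q)) ⟩
    ∑[ t ← allVec 3 ] Q (param t) ∎
    where open ≡-Reasoning

  restrict-0 : restrict 0v ≡ 0ᵥ
  restrict-0 = cong₂ _∷_ (⟨⟩-zeroˡ (u₁ E)) (cong₂ _∷_ (⟨⟩-zeroˡ (u₂ E)) (cong₂ _∷_ (⟨⟩-zeroˡ (u₃ E)) refl))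

  -- Count the pairs (f, t) with f (param t) = ⟨ c , t ⟩ in two ways. For fixed f they are the t in
  -- the kernel of restrict f ⊕ c: 8 of them if restrict f = c and 4 otherwise. For fixed t ≠ 0 they
  -- are the f with a prescribed value at param t ≠ 0v, 16 of them; for t = 0 all 32 f qualify.
  restriction-fibre-size : ∀ c → ∑[ f ← allVec 5 ] 𝟙 (restrict f ==ᵥ c) ≡ 4
  restriction-fibre-size c = *-cancelˡ-≡ _ 4 4 (+-cancelˡ-≡ 128 _ _ (begin
    128 + 4 * (∑[ f ← allVec 5 ] 𝟙 (restrict f ==ᵥ c))
      ≡⟨ cong₂ _+_ (∑-const (allVec 5) 4) (∑-*ˡ (allVec 5) 4 (λ f → 𝟙 (restrict f ==ᵥ c))) ⟨
    (∑[ f ← allVec 5 ] 4) + (∑[ f ← allVec 5 ] 4 * 𝟙 (restrict f ==ᵥ c))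
      ≡⟨ ∑-distrib-+ (allVec 5) (λ _ → 4) (λ f → 4 * 𝟙 (restrict f ==ᵥ c)) ⟨
    ∑[ f ← allVec 5 ] (4 + 4 * 𝟙 (restrict f ==ᵥ c))
      ≡⟨ ∑-cong (allVec 5) over-t ⟨
    ∑[ f ← allVec 5 ] ∑[ t ← allVec 3 ] agree f t
      ≡⟨ ∑-swap (allVec 5) (allVec 3) agree ⟩
    ∑[ t ← allVec 3 ] ∑[ f ← allVec 5 ] agree f t
      ≡⟨ ∑-cong (allVec 3) over-f ⟩
    ∑[ t ← allVec 3 ] (16 + 𝟙 (t ==ᵥ 0ᵥ) * 16)
      ≡⟨ ∑-distrib-+ (allVec 3) (λ _ → 16) (λ t → 𝟙 (t ==ᵥ 0ᵥ) * 16) ⟩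
    (∑[ t ← allVec 3 ] 16) + (∑[ t ← allVec 3 ] 𝟙 (t ==ᵥ 0ᵥ) * 16)
      ≡⟨ cong₂ _+_ (∑-const (allVec 3) 16) (∑-δ (0ᵥ {3}) (λ _ → 16)) ⟩
    128 + 4 * 4 ∎))
    where
    open ≡-Reasoning

    agree : V5 → F₂³ → ℕ
    agree f t = 𝟙 (not (dot f (param t) xor ⟨ c , t ⟩))

    over-t : ∀ f → ∑[ t ← allVec 3 ] agree f t ≡ 4 + 4 * 𝟙 (restrict f ==ᵥ c)
    over-t f = trans (∑-cong (allVec 3) (λ t → cong (𝟙 ∘ not) (agree≡ t))) (by-cases (restrict f ==ᵥ c) refl)
      where
      agree≡ : ∀ t → dot f (param t) xor ⟨ c , t ⟩ ≡ ⟨ restrict f ⊕ᵥ c , t ⟩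
      agree≡ t = trans (cong (_xor ⟨ c , t ⟩) (dot-param f t)) (sym (⟨⟩-distribˡ-⊕ (restrict f) c t))
      by-cases : ∀ b → restrict f ==ᵥ c ≡ b → ∑[ t ← allVec 3 ] 𝟙 (not ⟨ restrict f ⊕ᵥ c , t ⟩) ≡ 4 + 4 * 𝟙 b
      by-cases true  r≡c rewrite ==ᵥ⇒≡ (restrict f) c r≡c | ⊕ᵥ-self c =
        trans (∑-cong (allVec 3) (cong (𝟙 ∘ not) ∘ ⟨⟩-zeroˡ)) (∑-const (allVec 3) 1)
      by-cases false r≢c = kernel-size (restrict f ⊕ᵥ c) (==ᵥ-false⇒≢ (restrict f) c r≢c ∘ ⊕ᵥ≡0⇒≡ (restrict f) c)

    over-f : ∀ t → ∑[ f ← allVec 5 ] agree f t ≡ 16 + 𝟙 (t ==ᵥ 0ᵥ) * 16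
    over-f t = by-cases (t ≟ᵥ 0ᵥ)
      where
      by-cases : (t≟0 : Dec (t ≡ 0ᵥ)) → ∑[ f ← allVec 5 ] agree f t ≡ 16 + 𝟙 (does t≟0) * 16
      by-cases (yes refl) =
        trans (∑-cong (allVec 5) (λ f → cong₂ (λ x y → 𝟙 (not (x xor y))) (⟨⟩-zeroʳ f) (⟨⟩-zeroʳ c))) (∑-const (allVec 5) 1)
      by-cases (no t≢0) =
        trans (functionals-with-value (param t) (t≢0 ∘ param≡0⇒≡0 t) ⟨ c , t ⟩) (sym (+-identityʳ 16))

  restrict≡0 : ∀ f → (∀ p → p ∈P E → dot f p ≡ false) → restrict f ≡ 0ᵥ
  restrict≡0 f E⊆ker = cong₂ _∷_ (E⊆ker (u₁ E) (true , false , false , sym (⊕ᵥ-identityʳ (u₁ E))))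
    (cong₂ _∷_ (E⊆ker (u₂ E) (false , true , false , sym (trans (⊕ᵥ-identityˡ _) (⊕ᵥ-identityʳ (u₂ E)))))
      (cong₂ _∷_ (E⊆ker (u₃ E) (false , false , true , sym (trans (⊕ᵥ-identityˡ _) (⊕ᵥ-identityˡ (u₃ E))))) refl))

  kernel-in-plane : ∀ f → ∑[ p ← allVec 5 ] 𝟙ker f p * 𝟙 (inE p) ≡ ∑[ t ← allVec 3 ] 𝟙 (not ⟨ restrict f , t ⟩)
  kernel-in-plane f = trans (∑-plane (𝟙ker f)) (∑-cong (allVec 3) (cong (𝟙 ∘ not) ∘ dot-param f))

  restrict-surjective : ∀ c → ∃[ f ] restrict f ≡ c
  restrict-surjective c = map₂ (λ {f} → ==ᵥ⇒≡ (restrict f) c)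
    (∑-𝟙-positive⇒∃ (allVec 5) (λ f → restrict f ==ᵥ c) (subst (0 <_) (sym (restriction-fibre-size c)) (s≤s z≤n)))

-- Lines of a plane and their duals

module PlaneLines (E : Plane) where

  open PlaneCoordinates E

  coordinates : ∀ {p} → p ∈P E → F₂³
  coordinates (x , y , z , _) = x ∷ y ∷ z ∷ []

  param-coordinates : ∀ {p} (p∈E : p ∈P E) → p ≡ param (coordinates p∈E)
  param-coordinates (_ , _ , _ , eq) = eq

  off-plane : ∀ L {p} → LineInPlane L E → ¬ (p ∈P E) → onLine p L ≡ false
  off-plane L {p} L⊆E p∉E with onLine p L in p∈L
  ... | true  = contradiction (L⊆E p p∈L) p∉E
  ... | false = refl

  module _ (L : Line) (L⊆E : LineInPlane L E) where

    private
      α β : F₂³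
      α = coordinates (L⊆E (a L) (onLine-a L))
      β = coordinates (L⊆E (b L) (onLine-b L))

      a≡ : a L ≡ param α
      a≡ = param-coordinates (L⊆E (a L) (onLine-a L))

      b≡ : b L ≡ param β
      b≡ = param-coordinates (L⊆E (b L) (onLine-b L))

      independent : Independent α β
      independent = (λ α≡0 → a≢0 L (trans a≡ (cong param α≡0)))
                  , (λ β≡0 → b≢0 L (trans b≡ (cong param β≡0)))
                  , (λ α≡β → a≢b L (trans a≡ (trans (cong param α≡β) (sym b≡))))

    -- In coordinates L is the line of F₂³ spanned by α and β, i.e. the kernel of α ×ᵥ β.
    dual : F₂³
    dual = α ×ᵥ β

    dual≢0 : dual ≢ 0ᵥ
    dual≢0 = ×ᵥ-nonzero α β independent

    onLine-param : ∀ s → onLine (param s) L ≡ (not (s ==ᵥ 0ᵥ) ∧ not ⟨ dual , s ⟩)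
    onLine-param s = begin
      onLine (param s) L
        ≡⟨ cong₂ (λ x y → (param s == x) ∨ (param s == y) ∨ (param s == (x ⊕ y))) a≡ b≡ ⟩
      (param s == param α) ∨ (param s == param β) ∨ (param s == (param α ⊕ param β))
        ≡⟨ cong (λ z → (param s == param α) ∨ (param s == param β) ∨ (param s == z)) (param-⊕ α β) ⟩
      (param s == param α) ∨ (param s == param β) ∨ (param s == param (α ⊕ᵥ β))
        ≡⟨ cong₂ _∨_ (==-param s α) (cong₂ _∨_ (==-param s β) (==-param s (α ⊕ᵥ β))) ⟩
      (s ==ᵥ α) ∨ (s ==ᵥ β) ∨ (s ==ᵥ (α ⊕ᵥ β))
        ≡⟨ span-points α β s independent ⟩
      not (s ==ᵥ 0ᵥ) ∧ not ⟨ dual , s ⟩ ∎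
      where open ≡-Reasoning

    ⊄ker-restrict : ∀ f → L ⊄ker f ≡ not (restrict f ==ᵥ 0ᵥ ∨ restrict f ==ᵥ dual)
    ⊄ker-restrict f = begin
      dot f (a L) ∨ dot f (b L)                 ≡⟨ cong₂ (λ x y → dot f x ∨ dot f y) a≡ b≡ ⟩
      dot f (param α) ∨ dot f (param β)         ≡⟨ cong₂ _∨_ (dot-param f α) (dot-param f β) ⟩
      ⟨ restrict f , α ⟩ ∨ ⟨ restrict f , β ⟩ ≡⟨ span-⊄ker α β (restrict f) independent ⟩
      not (restrict f ==ᵥ 0ᵥ ∨ restrict f ==ᵥ dual) ∎
      where open ≡-Reasoning

  dual-injective : ∀ L M (L⊆E : LineInPlane L E) (M⊆E : LineInPlane M E) →
                   dual L L⊆E ≡ dual M M⊆E → SameLine L M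
  dual-injective L M L⊆E M⊆E eq p with p ∈E?
  ... | yes (x , y , z , refl) =
    trans (onLine-param L L⊆E s) (trans (cong (λ γ → not (s ==ᵥ 0ᵥ) ∧ not ⟨ γ , s ⟩) eq) (sym (onLine-param M M⊆E s)))
    where
    s : F₂³
    s = x ∷ y ∷ z ∷ []
  ... | no p∉E = trans (off-plane L L⊆E p∉E) (sym (off-plane M M⊆E p∉E))

-- Injections into a set of the same size

∑-allFin-suc : ∀ {n} (g : Fin (suc n) → ℕ) → ∑ (allFin (suc n)) g ≡ g zero + ∑ (allFin n) (g ∘ suc)
∑-allFin-suc {n} g = cong (g zero +_) (trans (cong (λ xs → ∑ xs g) (sym (map-tabulate id suc))) (∑-map suc (allFin n) g))

count-toList : ∀ {A : Set} {n} (P : A → Bool) (xs : Vec A n) → count P (toList xs) ≡ ∑[ i ← allFin n ] 𝟙 (P (lookup xs i))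
count-toList P []       = refl
count-toList P (x ∷ xs) = begin
  count P (x ∷ toList xs)
    ≡⟨ count≡∑ P (x ∷ toList xs) ⟩
  𝟙 (P x) + (∑[ y ← toList xs ] 𝟙 (P y))
    ≡⟨ cong (𝟙 (P x) +_) (trans (sym (count≡∑ P (toList xs))) (count-toList P xs)) ⟩
  𝟙 (P x) + (∑[ i ← allFin _ ] 𝟙 (P (lookup xs i)))
    ≡⟨ ∑-allFin-suc (λ i → 𝟙 (P (lookup (x ∷ xs) i))) ⟨
  ∑[ i ← allFin _ ] 𝟙 (P (lookup (x ∷ xs) i)) ∎
  where open ≡-Reasoning

∑-𝟙-at-most-once : ∀ {n} (P : Fin n → Bool) → (∀ i j → P i ≡ true → P j ≡ true → i ≡ j) →
                   ∑[ i ← allFin n ] 𝟙 (P i) ≤ 1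
∑-𝟙-at-most-once {zero}  P once = z≤n
∑-𝟙-at-most-once {suc n} P once rewrite ∑-allFin-suc (𝟙 ∘ P) with P zero in P₀
... | true  = ≤-reflexive (cong suc (trans (∑-cong (allFin n) none) (∑-zero (allFin n))))
  where
  none : ∀ i → 𝟙 (P (suc i)) ≡ 0
  none i with P (suc i) in Pᵢ
  ... | true  = contradiction (once zero (suc i) P₀ Pᵢ) (λ ())
  ... | false = refl
... | false = ∑-𝟙-at-most-once (P ∘ suc) (λ i j Pi Pj → Fin.suc-injective (once (suc i) (suc j) Pi Pj))

preimage-count : ∀ {m n} → (Fin n → Vec Bool m) → Vec Bool m → ℕ
preimage-count {n = n} γ c = ∑[ i ← allFin n ] 𝟙 (c ==ᵥ γ i)

module _ {m n : ℕ} (S : Vec Bool m → Bool) (γ : Fin n → Vec Bool m)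
         (γ-injective : ∀ i j → γ i ≡ γ j → i ≡ j) (γ∈S : ∀ i → S (γ i) ≡ true)
         (|S|≡n : ∑[ c ← allVec m ] 𝟙 (S c) ≡ n) where

  private
    preimage-count≤1 : ∀ c → preimage-count γ c ≤ 1
    preimage-count≤1 c = ∑-𝟙-at-most-once (λ i → c ==ᵥ γ i)
      (λ i j ci cj → γ-injective i j (trans (sym (==ᵥ⇒≡ c (γ i) ci)) (==ᵥ⇒≡ c (γ j) cj)))

    total : ∑[ c ← allVec m ] 𝟙 (S c) * preimage-count γ c ≡ n
    total = begin
      ∑[ c ← allVec m ] 𝟙 (S c) * preimage-count γ c
        ≡⟨ ∑-cong (allVec m) (λ c → sym (∑-*ˡ (allFin n) (𝟙 (S c)) (λ i → 𝟙 (c ==ᵥ γ i)))) ⟩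
      ∑[ c ← allVec m ] ∑[ i ← allFin n ] 𝟙 (S c) * 𝟙 (c ==ᵥ γ i)
        ≡⟨ ∑-swap (allVec m) (allFin n) (λ c i → 𝟙 (S c) * 𝟙 (c ==ᵥ γ i)) ⟩
      ∑[ i ← allFin n ] ∑[ c ← allVec m ] 𝟙 (S c) * 𝟙 (c ==ᵥ γ i)
        ≡⟨ ∑-cong (allFin n) (λ i → trans (∑-cong (allVec m) (λ c → *-comm (𝟙 (S c)) _)) (∑-δ (γ i) (𝟙 ∘ S))) ⟩
      ∑[ i ← allFin n ] 𝟙 (S (γ i))
        ≡⟨ ∑-cong (allFin n) (cong 𝟙 ∘ γ∈S) ⟩
      ∑[ i ← allFin n ] 1
        ≡⟨ trans (∑-const (allFin n) 1) (trans (*-identityʳ _) (length-tabulate id)) ⟩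
      n ∎
      where open ≡-Reasoning

  injective⇒preimage-count≡1 : ∀ c → S c ≡ true → preimage-count γ c ≡ 1
  injective⇒preimage-count≡1 c Sc = begin
    preimage-count γ c           ≡⟨ *-identityˡ (preimage-count γ c) ⟨
    1 * preimage-count γ c       ≡⟨ cong (λ b → 𝟙 b * preimage-count γ c) Sc ⟨
    𝟙 (S c) * preimage-count γ c ≡⟨ ∑-tight (allVec m) bound (trans total (sym |S|≡n)) (∈-allVec c) ⟩
    𝟙 (S c)                      ≡⟨ cong 𝟙 Sc ⟩
    1                            ∎
    where
    open ≡-Reasoning
    bound : ∀ c → 𝟙 (S c) * preimage-count γ c ≤ 𝟙 (S c)
    bound c = ≤-trans (*-monoʳ-≤ (𝟙 (S c)) (preimage-count≤1 c)) (≤-reflexive (*-identityʳ _))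

-- The code C(g, h, v, e)

weight-codeword : ∀ Ls f → weight (codeword Ls f) ≡ count (_⊄ker f) Ls
weight-codeword Ls f = count-map _ _ Ls

count-multisetC : ∀ P g h v e l₀ (Os : Vec Line 6) (Vs Es : Vec Line 8) →
  count P (multisetC g h v e l₀ Os Vs Es) ≡
  g * 𝟙 (P l₀) + (h * count P (toList Os) + (v * count P (toList Vs) + e * count P (toList Es)))
count-multisetC P g h v e l₀ Os Vs Es = begin
  count P (replicate g l₀ ++ (O ++ (V ++ E)))
    ≡⟨ count≡∑ P (replicate g l₀ ++ (O ++ (V ++ E))) ⟩
  ∑ (replicate g l₀ ++ (O ++ (V ++ E))) f
    ≡⟨ ∑-++ (replicate g l₀) (O ++ (V ++ E)) f ⟩
  ∑ (replicate g l₀) f + ∑ (O ++ (V ++ E)) f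
    ≡⟨ cong (∑ (replicate g l₀) f +_) (trans (∑-++ O (V ++ E) f) (cong (∑ O f +_) (∑-++ V E f))) ⟩
  ∑ (replicate g l₀) f + (∑ O f + (∑ V f + ∑ E f))
    ≡⟨ cong₂ _+_ (∑-replicate g l₀ f) (cong₂ _+_ (∑-concat-replicate h (toList Os) f)
                 (cong₂ _+_ (∑-concat-replicate v (toList Vs) f) (∑-concat-replicate e (toList Es) f))) ⟩
  g * f l₀ + (h * ∑ (toList Os) f + (v * ∑ (toList Vs) f + e * ∑ (toList Es) f))
    ≡⟨ cong₂ (λ x y → g * f l₀ + (h * x + y)) (count≡∑ P (toList Os))
             (cong₂ (λ x y → v * x + e * y) (count≡∑ P (toList Vs)) (count≡∑ P (toList Es))) ⟨
  g * 𝟙 (P l₀) + (h * count P (toList Os) + (v * count P (toList Vs) + e * count P (toList Es))) ∎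
  where
  open ≡-Reasoning
  f : Line → ℕ
  f = 𝟙 ∘ P
  O V E : List Line
  O = concat (map (replicate h) (toList Os))
  V = concat (map (replicate v) (toList Vs))
  E = concat (map (replicate e) (toList Es))

weight-multisetC : ∀ g h v e l₀ (Os : Vec Line 6) (Vs Es : Vec Line 8) f →
  weight (codeword (multisetC g h v e l₀ Os Vs Es) f) ≡
  g * 𝟙 (l₀ ⊄ker f) + (h * #⊄ker f Os + (v * #⊄ker f Vs + e * #⊄ker f Es))
weight-multisetC g h v e l₀ Os Vs Es f =
  trans (weight-codeword (multisetC g h v e l₀ Os Vs Es) f) (count-multisetC (_⊄ker f) g h v e l₀ Os Vs Es)

length-multisetC : ∀ g h v e l₀ (Os : Vec Line 6) (Vs Es : Vec Line 8) →
  length (multisetC g h v e l₀ Os Vs Es) ≡ g + 6 * h + 8 * (v + e)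
length-multisetC g h v e l₀ Os Vs Es = begin
  length (multisetC g h v e l₀ Os Vs Es)
    ≡⟨ length≡count-true (multisetC g h v e l₀ Os Vs Es) ⟩
  count (λ _ → true) (multisetC g h v e l₀ Os Vs Es)
    ≡⟨ count-multisetC (λ _ → true) g h v e l₀ Os Vs Es ⟩
  g * 1 + (h * count (λ _ → true) (toList Os) + (v * count (λ _ → true) (toList Vs) + e * count (λ _ → true) (toList Es)))
    ≡⟨ cong₂ (λ x y → g * 1 + (h * x + y)) (size Os) (cong₂ (λ x y → v * x + e * y) (size Vs) (size Es)) ⟩
  g * 1 + (h * 6 + (v * 8 + e * 8))
    ≡⟨ solve (g List.∷ h List.∷ v List.∷ e List.∷ List.[]) ⟩
  g + 6 * h + 8 * (v + e) ∎
  where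
  open ≡-Reasoning
  size : ∀ {n} (Ls : Vec Line n) → count (λ _ → true) (toList Ls) ≡ n
  size Ls = trans (sym (length≡count-true (toList Ls))) (length-toList Ls)

weight-codeword-⊕ : ∀ Ls f f′ → codeword Ls f ≡ codeword Ls f′ → weight (codeword Ls (f ⊕ f′)) ≡ 0
weight-codeword-⊕ Ls f f′ eq = trans (weight-codeword Ls (f ⊕ f′)) (none Ls eq)
  where
  vanishes : ∀ p → dot f p ≡ dot f′ p → dot (f ⊕ f′) p ≡ false
  vanishes p fp≡f′p = trans (⟨⟩-distribˡ-⊕ f f′ p) (trans (cong (_xor dot f′ p) fp≡f′p) (xor-same (dot f′ p)))
  none : ∀ Ls → codeword Ls f ≡ codeword Ls f′ → count (_⊄ker (f ⊕ f′)) Ls ≡ 0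
  none []       _  = refl
  none (L ∷ Ls) eq with ∷-injective eq
  ... | heads , tails = begin
    count (_⊄ker (f ⊕ f′)) (L ∷ Ls)               ≡⟨ count≡∑ (_⊄ker (f ⊕ f′)) (L ∷ Ls) ⟩
    𝟙 (L ⊄ker (f ⊕ f′)) + ∑ Ls (𝟙 ∘ (_⊄ker (f ⊕ f′))) ≡⟨ cong₂ _+_ (cong 𝟙 L⊆ker) (sym (count≡∑ (_⊄ker (f ⊕ f′)) Ls)) ⟩
    count (_⊄ker (f ⊕ f′)) Ls                     ≡⟨ none Ls tails ⟩
    0                                              ∎
    where
    open ≡-Reasoning
    L⊆ker : L ⊄ker (f ⊕ f′) ≡ false
    L⊆ker = cong₂ _∨_ (vanishes (a L) (cong proj₁ heads)) (vanishes (b L) (cong proj₂ heads))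

⊓-closed : (P : ℕ → Set) {x y : ℕ} → P x → P y → P (x ⊓ y)
⊓-closed P {x} {y} Px Py with ⊓-sel x y
... | inj₁ x⊓y≡x = subst P (sym x⊓y≡x) Px
... | inj₂ x⊓y≡y = subst P (sym x⊓y≡y) Py

-- The configuration of the theorem

module Configuration
  (l₀ : Line) (E₀ : Plane) (H₀ : V5) (H₀≢0 : H₀ ≢ 0v)
  (l₀⊆E₀ : LineInPlane l₀ E₀) (E₀⊆H₀ : PlaneInHyperplane E₀ H₀)
  (Os : Vec Line 6) (Os-distinct : Distinct Os)
  (Os⊆E₀ : (i : Fin 6) → LineInPlane (lookup Os i) E₀ × ¬ SameLine (lookup Os i) l₀)
  (Vs : Vec Line 8)
  (Vs-on-E₀∖l₀ : (p : V5) → p ≢ 0v → p ∈P E₀ → onLine p l₀ ≡ false → linesThrough p Vs ≡ 2)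
  (Vs-off-H₀ : (p : V5) → p ≢ 0v → ¬ (p ∈H H₀) → linesThrough p Vs ≡ 1)
  (Es : Vec Line 8)
  (Es-off-E₀ : (i : Fin 8) (p : V5) → onLine p (lookup Es i) ≡ true → ¬ (p ∈P E₀))
  (Es-cover : (p : V5) → p ≢ 0v → ¬ (p ∈P E₀) → linesThrough p Es ≡ 1) where

  open PlaneCoordinates E₀
  open PlaneLines E₀

  γ₀ : F₂³
  γ₀ = dual l₀ l₀⊆E₀

  γ : Fin 6 → F₂³
  γ i = dual (lookup Os i) (proj₁ (Os⊆E₀ i))

  γ-injective : ∀ i j → γ i ≡ γ j → i ≡ j
  γ-injective i j γi≡γj with i Fin.≟ j
  ... | yes i≡j = i≡j
  ... | no  i≢j = contradiction (dual-injective (lookup Os i) (lookup Os j) (proj₁ (Os⊆E₀ i)) (proj₁ (Os⊆E₀ j)) γi≡γj) (Os-distinct i j i≢j)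

  γ≢γ₀ : ∀ i → γ i ≢ γ₀
  γ≢γ₀ i = proj₂ (Os⊆E₀ i) ∘ dual-injective (lookup Os i) l₀ (proj₁ (Os⊆E₀ i)) l₀⊆E₀

  -- The six duals γ i are distinct and avoid 0 and γ₀, so they exhaust the rest of F₂³.
  preimage-count-other : ∀ c → c ≢ 0ᵥ → c ≢ γ₀ → preimage-count γ c ≡ 1
  preimage-count-other c c≢0 c≢γ₀ =
    injective⇒preimage-count≡1 (avoids γ₀) γ γ-injective (λ i → avoids-intro (dual≢0 _ (proj₁ (Os⊆E₀ i))) (γ≢γ₀ i))
      (#avoids γ₀ (dual≢0 l₀ l₀⊆E₀)) c (avoids-intro c≢0 c≢γ₀)

  preimage-count-γ₀ : preimage-count γ γ₀ ≡ 0
  preimage-count-γ₀ = trans (∑-cong (allFin 6) (λ i → cong 𝟙 (≢⇒==ᵥ-false (γ≢γ₀ i ∘ sym)))) (∑-zero (allFin 6))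

  l₀⊄ker : ∀ f → l₀ ⊄ker f ≡ not (restrict f ==ᵥ 0ᵥ ∨ restrict f ==ᵥ γ₀)
  l₀⊄ker = ⊄ker-restrict l₀ l₀⊆E₀

  #⊄ker-Os : ∀ f → #⊄ker f Os ≡ ∑[ i ← allFin 6 ] 𝟙 (not (restrict f ==ᵥ 0ᵥ ∨ restrict f ==ᵥ γ i))
  #⊄ker-Os f = trans (count-toList (_⊄ker f) Os) (∑-cong (allFin 6) (λ i → cong 𝟙 (⊄ker-restrict (lookup Os i) (proj₁ (Os⊆E₀ i)) f)))

  #⊄ker-Os-vanishing : ∀ f → restrict f ≡ 0ᵥ → #⊄ker f Os ≡ 0
  #⊄ker-Os-vanishing f r≡0 = trans (#⊄ker-Os f)
    (trans (∑-cong (allFin 6) (λ i → cong (λ r → 𝟙 (not (r ==ᵥ 0ᵥ ∨ r ==ᵥ γ i))) r≡0)) (∑-zero (allFin 6)))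

  #⊄ker-Os-nonvanishing : ∀ f → restrict f ≢ 0ᵥ → #⊄ker f Os + preimage-count γ (restrict f) ≡ 6
  #⊄ker-Os-nonvanishing f r≢0 = begin
    #⊄ker f Os + preimage-count γ r
      ≡⟨ cong (_+ preimage-count γ r)
              (trans (#⊄ker-Os f) (∑-cong (allFin 6) (λ i → cong (λ b → 𝟙 (not (b ∨ r ==ᵥ γ i))) (≢⇒==ᵥ-false r≢0)))) ⟩
    (∑[ i ← allFin 6 ] 𝟙 (not (r ==ᵥ γ i))) + preimage-count γ r
      ≡⟨ +-comm _ (preimage-count γ r) ⟩
    (∑[ i ← allFin 6 ] 𝟙 (r ==ᵥ γ i)) + (∑[ i ← allFin 6 ] 𝟙 (not (r ==ᵥ γ i)))
      ≡⟨ ∑-𝟙-complement (allFin 6) (λ i → r ==ᵥ γ i) ⟩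
    length (allFin 6) ∎
    where
    open ≡-Reasoning
    r : F₂³
    r = restrict f

  inE₀∖l₀ : V5 → Bool
  inE₀∖l₀ p = inE p ∧ not (onLine p l₀) ∧ not (p == 0v)

  0∈E₀ : 0v ∈P E₀
  0∈E₀ = false , false , false , refl

  𝟙-inE-split : ∀ p → 𝟙 (inE p) ≡ 𝟙 (inE₀∖l₀ p) + 𝟙 (onLine p l₀) + 𝟙 (p == 0v)
  𝟙-inE-split p = 𝟙-split₃ (λ p∈l₀ → ∈⇒inE (l₀⊆E₀ p p∈l₀))
    (λ p≡0 → subst (λ q → inE q ≡ true × onLine q l₀ ≡ false) (sym (==ᵥ⇒≡ p 0v p≡0)) (∈⇒inE 0∈E₀ , onLine-0 l₀))

  ∑-E₀-split : ∀ (Q : V5 → ℕ) → ∑[ p ← allVec 5 ] Q p * 𝟙 (inE p) ≡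
    (∑[ p ← allVec 5 ] Q p * 𝟙 (inE₀∖l₀ p)) + (Q (a l₀) + Q (b l₀) + Q (a l₀ ⊕ b l₀)) + Q 0v
  ∑-E₀-split Q = begin
    ∑[ p ← allVec 5 ] Q p * 𝟙 (inE p)
      ≡⟨ ∑-cong (allVec 5) (λ p → trans (cong (Q p *_) (𝟙-inE-split p))
                                        (*-distribˡ-+₃ (Q p) (𝟙 (inE₀∖l₀ p)) (𝟙 (onLine p l₀)) (𝟙 (p == 0v)))) ⟩
    ∑[ p ← allVec 5 ] (Q p * 𝟙 (inE₀∖l₀ p) + Q p * 𝟙 (onLine p l₀) + Q p * 𝟙 (p == 0v))
      ≡⟨ ∑-distrib-+ (allVec 5) (λ p → Q p * 𝟙 (inE₀∖l₀ p) + Q p * 𝟙 (onLine p l₀)) (λ p → Q p * 𝟙 (p == 0v)) ⟩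
    (∑[ p ← allVec 5 ] (Q p * 𝟙 (inE₀∖l₀ p) + Q p * 𝟙 (onLine p l₀))) + (∑[ p ← allVec 5 ] Q p * 𝟙 (p == 0v))
      ≡⟨ cong₂ _+_ (∑-distrib-+ (allVec 5) (λ p → Q p * 𝟙 (inE₀∖l₀ p)) (λ p → Q p * 𝟙 (onLine p l₀))) (∑-δʳ 0v Q) ⟩
    (∑[ p ← allVec 5 ] Q p * 𝟙 (inE₀∖l₀ p)) + (∑[ p ← allVec 5 ] Q p * 𝟙 (onLine p l₀)) + Q 0v
      ≡⟨ cong (λ x → (∑[ p ← allVec 5 ] Q p * 𝟙 (inE₀∖l₀ p)) + x + Q 0v) (∑-onLine Q l₀) ⟩
    (∑[ p ← allVec 5 ] Q p * 𝟙 (inE₀∖l₀ p)) + (Q (a l₀) + Q (b l₀) + Q (a l₀ ⊕ b l₀)) + Q 0v ∎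
    where open ≡-Reasoning

  #E₀∖l₀ : ∑[ p ← allVec 5 ] 𝟙 (inE₀∖l₀ p) ≡ 4
  #E₀∖l₀ = +-cancelʳ-≡ 4 _ 4 (begin
    (∑[ p ← allVec 5 ] 𝟙 (inE₀∖l₀ p)) + 4
      ≡⟨ cong (_+ 4) (∑-cong (allVec 5) (λ p → sym (*-identityˡ (𝟙 (inE₀∖l₀ p))))) ⟩
    (∑[ p ← allVec 5 ] 1 * 𝟙 (inE₀∖l₀ p)) + 4
      ≡⟨ +-assoc _ 3 1 ⟨
    (∑[ p ← allVec 5 ] 1 * 𝟙 (inE₀∖l₀ p)) + 3 + 1
      ≡⟨ ∑-E₀-split (λ _ → 1) ⟨
    ∑[ p ← allVec 5 ] 1 * 𝟙 (inE p)
      ≡⟨ ∑-plane (λ _ → 1) ⟩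
    8 ∎)
    where open ≡-Reasoning

  Es-multiplicity : ∀ p → linesThrough p Es ≡ 𝟙 (not (inE p))
  Es-multiplicity p with inE p in p∈E
  ... | true  = trans (count-toList (onLine p) Es) (trans (∑-cong (allFin 8) misses) (∑-zero (allFin 8)))
    where
    misses : ∀ i → 𝟙 (onLine p (lookup Es i)) ≡ 0
    misses i with onLine p (lookup Es i) in p∈Eᵢ
    ... | true  = contradiction (inE⇒∈ p∈E) (Es-off-E₀ i p p∈Eᵢ)
    ... | false = refl
  ... | false = Es-cover p (λ p≡0 → contradiction (trans (sym (∈⇒inE (subst (_∈P E₀) (sym p≡0) 0∈E₀))) p∈E) λ ())
                           (inE⇒∉ p∈E)

  Vs-lower : ∀ p → 2 * 𝟙 (inE₀∖l₀ p) + 𝟙 (dot H₀ p) ≤ linesThrough p Vs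
  Vs-lower p with inE₀∖l₀ p in p∈E₀∖l₀
  ... | true  = ≤-reflexive (trans (cong (λ b → 2 + 𝟙 b) (E₀⊆H₀ p p∈E)) (sym (Vs-on-E₀∖l₀ p p≢0 p∈E p∉l₀)))
    where
    p∈E : p ∈P E₀
    p∈E = inE⇒∈ (∧-conicalˡ (inE p) _ p∈E₀∖l₀)
    p∉l₀ : onLine p l₀ ≡ false
    p∉l₀ = not-injective (∧-conicalˡ (not (onLine p l₀)) _ (∧-conicalʳ (inE p) _ p∈E₀∖l₀))
    p≢0 : p ≢ 0v
    p≢0 = ==ᵥ-false⇒≢ p 0v (not-injective (∧-conicalʳ (not (onLine p l₀)) _ (∧-conicalʳ (inE p) _ p∈E₀∖l₀)))
  ... | false with dot H₀ p in p∉H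
  ...   | true  = ≤-reflexive (sym (Vs-off-H₀ p (⟨⟩≡true⇒≢0 H₀ p p∉H) (λ p∈H → contradiction (trans (sym p∉H) p∈H) λ ())))
  ...   | false = z≤n

  -- The hypotheses say nothing about the points of H₀ ∖ E₀, but the lower bound is attained
  -- everywhere since both sides sum to 24: 3 points on each of the 8 lines.
  Vs-multiplicity : ∀ p → linesThrough p Vs ≡ 2 * 𝟙 (inE₀∖l₀ p) + 𝟙 (dot H₀ p)
  Vs-multiplicity p = sym (∑-tight (allVec 5) Vs-lower (trans lower-total (sym (∑-linesThrough Vs))) (∈-allVec p))
    where
    lower-total : ∑[ p ← allVec 5 ] (2 * 𝟙 (inE₀∖l₀ p) + 𝟙 (dot H₀ p)) ≡ 8 * 3
    lower-total = begin
      ∑[ p ← allVec 5 ] (2 * 𝟙 (inE₀∖l₀ p) + 𝟙 (dot H₀ p))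
        ≡⟨ ∑-distrib-+ (allVec 5) (λ p → 2 * 𝟙 (inE₀∖l₀ p)) (λ p → 𝟙 (dot H₀ p)) ⟩
      (∑[ p ← allVec 5 ] 2 * 𝟙 (inE₀∖l₀ p)) + (∑[ p ← allVec 5 ] 𝟙 (dot H₀ p))
        ≡⟨ cong₂ _+_ (trans (∑-*ˡ (allVec 5) 2 (𝟙 ∘ inE₀∖l₀)) (cong (2 *_) #E₀∖l₀)) (kernel-complement-size H₀ H₀≢0) ⟩
      8 * 3 ∎
      where open ≡-Reasoning

  #ker∩E₀ #ker∩E₀∖l₀ #ker∖H₀ : V5 → ℕ
  #ker∩E₀ f = ∑[ p ← allVec 5 ] 𝟙ker f p * 𝟙 (inE p)
  #ker∩E₀∖l₀ f = ∑[ p ← allVec 5 ] 𝟙ker f p * 𝟙 (inE₀∖l₀ p)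
  #ker∖H₀ f = ∑[ p ← allVec 5 ] 𝟙ker f p * 𝟙 (dot H₀ p)

  #ker∩E₀-vanishing : ∀ f → restrict f ≡ 0ᵥ → #ker∩E₀ f ≡ 8
  #ker∩E₀-vanishing f r≡0 = trans (kernel-in-plane f)
    (trans (∑-cong (allVec 3) (λ t → trans (cong (λ r → 𝟙 (not ⟨ r , t ⟩)) r≡0) (cong (𝟙 ∘ not) (⟨⟩-zeroˡ t)))) (∑-const (allVec 3) 1))

  #ker∩E₀-nonvanishing : ∀ f → restrict f ≢ 0ᵥ → #ker∩E₀ f ≡ 4
  #ker∩E₀-nonvanishing f r≢0 = trans (kernel-in-plane f) (kernel-size (restrict f) r≢0)

  #ker∩E₀-split : ∀ f → #ker∩E₀∖l₀ f + (2 + 2 * 𝟙 (not (l₀ ⊄ker f))) ≡ #ker∩E₀ f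
  #ker∩E₀-split f = begin
    #ker∩E₀∖l₀ f + (2 + 2 * λ₀)
      ≡⟨ cong (λ x → #ker∩E₀∖l₀ f + suc x) (+-comm 1 (2 * λ₀)) ⟩
    #ker∩E₀∖l₀ f + ((1 + 2 * λ₀) + 1)
      ≡⟨ +-assoc (#ker∩E₀∖l₀ f) (1 + 2 * λ₀) 1 ⟨
    #ker∩E₀∖l₀ f + (1 + 2 * λ₀) + 1
      ≡⟨ cong₂ (λ x y → #ker∩E₀∖l₀ f + x + y) (kernel-points-on-line f l₀) (cong (𝟙 ∘ not) (⟨⟩-zeroʳ f)) ⟨
    #ker∩E₀∖l₀ f + (𝟙ker f (a l₀) + 𝟙ker f (b l₀) + 𝟙ker f (a l₀ ⊕ b l₀)) + 𝟙ker f 0v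
      ≡⟨ ∑-E₀-split (𝟙ker f) ⟨
    #ker∩E₀ f ∎
    where
    open ≡-Reasoning
    λ₀ : ℕ
    λ₀ = 𝟙 (not (l₀ ⊄ker f))

  #ker∖H₀-H₀ : #ker∖H₀ H₀ ≡ 0
  #ker∖H₀-H₀ = trans (∑-cong (allVec 5) (λ p → disjoint (dot H₀ p))) (∑-zero (allVec 5))
    where
    disjoint : ∀ b → 𝟙 (not b) * 𝟙 b ≡ 0
    disjoint true  = refl
    disjoint false = refl

  #ker∖H₀-other : ∀ f → f ≢ 0v → f ≢ H₀ → #ker∖H₀ f ≡ 8
  #ker∖H₀-other f f≢0 f≢H₀ = *-cancelˡ-≡ _ 8 2 (kernel-difference-size f H₀ f≢0 H₀≢0 f≢H₀)

  Vs-incidences : ∀ f → ∑[ p ← allVec 5 ] 𝟙ker f p * linesThrough p Vs ≡ 2 * #ker∩E₀∖l₀ f + #ker∖H₀ f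
  Vs-incidences f = begin
    ∑[ p ← allVec 5 ] 𝟙ker f p * linesThrough p Vs
      ≡⟨ ∑-cong (allVec 5) (λ p → trans (cong (𝟙ker f p *_) (Vs-multiplicity p))
                                        (*-distribˡ-+ (𝟙ker f p) (2 * 𝟙 (inE₀∖l₀ p)) (𝟙 (dot H₀ p)))) ⟩
    ∑[ p ← allVec 5 ] (𝟙ker f p * (2 * 𝟙 (inE₀∖l₀ p)) + 𝟙ker f p * 𝟙 (dot H₀ p))
      ≡⟨ ∑-distrib-+ (allVec 5) (λ p → 𝟙ker f p * (2 * 𝟙 (inE₀∖l₀ p))) (λ p → 𝟙ker f p * 𝟙 (dot H₀ p)) ⟩
    (∑[ p ← allVec 5 ] 𝟙ker f p * (2 * 𝟙 (inE₀∖l₀ p))) + #ker∖H₀ f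
      ≡⟨ cong (_+ #ker∖H₀ f) (trans (∑-cong (allVec 5) (λ p → x*yz≡y*xz (𝟙ker f p) 2 (𝟙 (inE₀∖l₀ p))))
                                    (∑-*ˡ (allVec 5) 2 (λ p → 𝟙ker f p * 𝟙 (inE₀∖l₀ p)))) ⟩
    2 * #ker∩E₀∖l₀ f + #ker∖H₀ f ∎
    where open ≡-Reasoning

  Es-incidences : ∀ f → f ≢ 0v → (∑[ p ← allVec 5 ] 𝟙ker f p * linesThrough p Es) + #ker∩E₀ f ≡ 16
  Es-incidences f f≢0 = begin
    (∑[ p ← allVec 5 ] 𝟙ker f p * linesThrough p Es) + #ker∩E₀ f
      ≡⟨ cong (_+ #ker∩E₀ f) (∑-cong (allVec 5) (λ p → cong (𝟙ker f p *_) (Es-multiplicity p))) ⟩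
    (∑[ p ← allVec 5 ] 𝟙ker f p * 𝟙 (not (inE p))) + #ker∩E₀ f
      ≡⟨ ∑-distrib-+ (allVec 5) (λ p → 𝟙ker f p * 𝟙 (not (inE p))) (λ p → 𝟙ker f p * 𝟙 (inE p)) ⟨
    ∑[ p ← allVec 5 ] (𝟙ker f p * 𝟙 (not (inE p)) + 𝟙ker f p * 𝟙 (inE p))
      ≡⟨ ∑-cong (allVec 5) (λ p → split (𝟙ker f p) (inE p)) ⟩
    ∑[ p ← allVec 5 ] 𝟙ker f p
      ≡⟨ kernel-size f f≢0 ⟩
    16 ∎
    where
    open ≡-Reasoning
    split : ∀ k b → k * 𝟙 (not b) + k * 𝟙 b ≡ k
    split k false = trans (cong (_+ k * 0) (*-identityʳ k)) (trans (cong (k +_) (*-zeroʳ k)) (+-identityʳ k))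
    split k true  = trans (cong (_+ k * 1) (*-zeroʳ k)) (*-identityʳ k)

  record OffKernelCounts (f : V5) (x₀ xO xV xE : ℕ) : Set where
    field
      l₀-off : 𝟙 (l₀ ⊄ker f) ≡ x₀
      Os-off : #⊄ker f Os ≡ xO
      Vs-off : #⊄ker f Vs ≡ xV
      Es-off : #⊄ker f Es ≡ xE

  -- In each case below the three inputs |ker f ∩ E₀|, [l₀ ⊆ ker f] and |ker f ∖ H₀| are known, and
  -- these helpers turn them into the numbers of lines of 𝒱 and ℰ inside ker f (the parameter k).
  private
    #ker∩E₀∖l₀-from : ∀ f {κ ℓ} m → #ker∩E₀ f ≡ κ → 𝟙 (not (l₀ ⊄ker f)) ≡ ℓ → m + (2 + 2 * ℓ) ≡ κ →
                      #ker∩E₀∖l₀ f ≡ m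
    #ker∩E₀∖l₀-from f {κ} {ℓ} m κ≡ ℓ≡ eq = +-cancelʳ-≡ (2 + 2 * ℓ) (#ker∩E₀∖l₀ f) m (begin
      #ker∩E₀∖l₀ f + (2 + 2 * ℓ)                      ≡⟨ cong (λ x → #ker∩E₀∖l₀ f + (2 + 2 * x)) ℓ≡ ⟨
      #ker∩E₀∖l₀ f + (2 + 2 * 𝟙 (not (l₀ ⊄ker f)))   ≡⟨ #ker∩E₀-split f ⟩
      #ker∩E₀ f                                     ≡⟨ trans κ≡ (sym eq) ⟩
      m + (2 + 2 * ℓ)                               ∎)
      where open ≡-Reasoning

    #⊄ker-Vs-from : ∀ f k {m h} → #ker∩E₀∖l₀ f ≡ m → #ker∖H₀ f ≡ h → 2 * m + h ≡ 8 + 2 * k → #⊄ker f Vs + k ≡ 8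
    #⊄ker-Vs-from f k m≡ h≡ eq = #⊄ker-from-incidences Vs f k (trans (Vs-incidences f) (trans (cong₂ (λ x y → 2 * x + y) m≡ h≡) eq))

    #⊄ker-Es-from : ∀ f k {κ} → f ≢ 0v → #ker∩E₀ f ≡ κ → 8 + 2 * k + κ ≡ 16 → #⊄ker f Es + k ≡ 8
    #⊄ker-Es-from f k {κ} f≢0 κ≡ eq = #⊄ker-from-incidences Es f k (+-cancelʳ-≡ κ _ _ (begin
      (∑[ p ← allVec 5 ] 𝟙ker f p * linesThrough p Es) + κ         ≡⟨ cong ((∑[ p ← allVec 5 ] 𝟙ker f p * linesThrough p Es) +_) κ≡ ⟨
      (∑[ p ← allVec 5 ] 𝟙ker f p * linesThrough p Es) + #ker∩E₀ f ≡⟨ Es-incidences f f≢0 ⟩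
      16                                                         ≡⟨ eq ⟨
      8 + 2 * k + κ                                              ∎))
      where open ≡-Reasoning

  restrict-H₀ : restrict H₀ ≡ 0ᵥ
  restrict-H₀ = restrict≡0 H₀ E₀⊆H₀

  nonvanishing⇒≢0 : ∀ f → restrict f ≢ 0ᵥ → f ≢ 0v
  nonvanishing⇒≢0 f r≢0 refl = r≢0 restrict-0

  nonvanishing⇒≢H₀ : ∀ f → restrict f ≢ 0ᵥ → f ≢ H₀
  nonvanishing⇒≢H₀ f r≢0 refl = r≢0 restrict-H₀

  l₀⊆ker-vanishing : ∀ f → restrict f ≡ 0ᵥ → l₀ ⊄ker f ≡ false
  l₀⊆ker-vanishing f r≡0 = trans (l₀⊄ker f) (cong (λ r → not (r ==ᵥ 0ᵥ ∨ r ==ᵥ γ₀)) r≡0)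

  counts-H₀ : OffKernelCounts H₀ 0 0 8 8
  counts-H₀ = record
    { l₀-off = cong 𝟙 l₀⊆ker
    ; Os-off = #⊄ker-Os-vanishing H₀ restrict-H₀
    ; Vs-off = +-cancelʳ-≡ 0 _ 8 (#⊄ker-Vs-from H₀ 0 ker∩E₀∖l₀ #ker∖H₀-H₀ refl)
    ; Es-off = +-cancelʳ-≡ 0 _ 8 (#⊄ker-Es-from H₀ 0 H₀≢0 ker∩E₀ refl)
    }
    where
    l₀⊆ker : l₀ ⊄ker H₀ ≡ false
    l₀⊆ker = l₀⊆ker-vanishing H₀ restrict-H₀
    ker∩E₀ : #ker∩E₀ H₀ ≡ 8
    ker∩E₀ = #ker∩E₀-vanishing H₀ restrict-H₀
    ker∩E₀∖l₀ : #ker∩E₀∖l₀ H₀ ≡ 4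
    ker∩E₀∖l₀ = #ker∩E₀∖l₀-from H₀ 4 ker∩E₀ (cong (𝟙 ∘ not) l₀⊆ker) refl

  counts-E₀⊆ker : ∀ f → f ≢ 0v → f ≢ H₀ → restrict f ≡ 0ᵥ → OffKernelCounts f 0 0 4 8
  counts-E₀⊆ker f f≢0 f≢H₀ r≡0 = record
    { l₀-off = cong 𝟙 l₀⊆ker
    ; Os-off = #⊄ker-Os-vanishing f r≡0
    ; Vs-off = +-cancelʳ-≡ 4 _ 4 (#⊄ker-Vs-from f 4 ker∩E₀∖l₀ (#ker∖H₀-other f f≢0 f≢H₀) refl)
    ; Es-off = +-cancelʳ-≡ 0 _ 8 (#⊄ker-Es-from f 0 f≢0 ker∩E₀ refl)
    }
    where
    l₀⊆ker : l₀ ⊄ker f ≡ false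
    l₀⊆ker = l₀⊆ker-vanishing f r≡0
    ker∩E₀ : #ker∩E₀ f ≡ 8
    ker∩E₀ = #ker∩E₀-vanishing f r≡0
    ker∩E₀∖l₀ : #ker∩E₀∖l₀ f ≡ 4
    ker∩E₀∖l₀ = #ker∩E₀∖l₀-from f 4 ker∩E₀ (cong (𝟙 ∘ not) l₀⊆ker) refl

  counts-ker∩E₀≡l₀ : ∀ f → restrict f ≡ γ₀ → OffKernelCounts f 0 6 8 6
  counts-ker∩E₀≡l₀ f r≡γ₀ = record
    { l₀-off = cong 𝟙 l₀⊆ker
    ; Os-off = +-cancelʳ-≡ 0 _ 6 (trans (cong (#⊄ker f Os +_) (sym no-O-in-ker)) (#⊄ker-Os-nonvanishing f r≢0))
    ; Vs-off = +-cancelʳ-≡ 0 _ 8 (#⊄ker-Vs-from f 0 ker∩E₀∖l₀ (#ker∖H₀-other f f≢0 (nonvanishing⇒≢H₀ f r≢0)) refl)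
    ; Es-off = +-cancelʳ-≡ 2 _ 6 (#⊄ker-Es-from f 2 f≢0 ker∩E₀ refl)
    }
    where
    r≢0 : restrict f ≢ 0ᵥ
    r≢0 = dual≢0 l₀ l₀⊆E₀ ∘ trans (sym r≡γ₀)
    f≢0 : f ≢ 0v
    f≢0 = nonvanishing⇒≢0 f r≢0
    l₀⊆ker : l₀ ⊄ker f ≡ false
    l₀⊆ker = trans (l₀⊄ker f) (cong₂ (λ x y → not (x ∨ y)) (≢⇒==ᵥ-false r≢0) (trans (cong (_==ᵥ γ₀) r≡γ₀) (==ᵥ-refl γ₀)))
    no-O-in-ker : preimage-count γ (restrict f) ≡ 0
    no-O-in-ker = trans (cong (preimage-count γ) r≡γ₀) preimage-count-γ₀
    ker∩E₀ : #ker∩E₀ f ≡ 4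
    ker∩E₀ = #ker∩E₀-nonvanishing f r≢0
    ker∩E₀∖l₀ : #ker∩E₀∖l₀ f ≡ 0
    ker∩E₀∖l₀ = #ker∩E₀∖l₀-from f 0 ker∩E₀ (cong (𝟙 ∘ not) l₀⊆ker) refl

  counts-ker∩E₀≢l₀ : ∀ f → restrict f ≢ 0ᵥ → restrict f ≢ γ₀ → OffKernelCounts f 1 5 6 6
  counts-ker∩E₀≢l₀ f r≢0 r≢γ₀ = record
    { l₀-off = cong 𝟙 l₀⊄ker-f
    ; Os-off = +-cancelʳ-≡ 1 _ 5 (trans (cong (#⊄ker f Os +_) (sym one-O-in-ker)) (#⊄ker-Os-nonvanishing f r≢0))
    ; Vs-off = +-cancelʳ-≡ 2 _ 6 (#⊄ker-Vs-from f 2 ker∩E₀∖l₀ (#ker∖H₀-other f f≢0 (nonvanishing⇒≢H₀ f r≢0)) refl)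
    ; Es-off = +-cancelʳ-≡ 2 _ 6 (#⊄ker-Es-from f 2 f≢0 ker∩E₀ refl)
    }
    where
    f≢0 : f ≢ 0v
    f≢0 = nonvanishing⇒≢0 f r≢0
    l₀⊄ker-f : l₀ ⊄ker f ≡ true
    l₀⊄ker-f = trans (l₀⊄ker f) (cong₂ (λ x y → not (x ∨ y)) (≢⇒==ᵥ-false r≢0) (≢⇒==ᵥ-false r≢γ₀))
    one-O-in-ker : preimage-count γ (restrict f) ≡ 1
    one-O-in-ker = preimage-count-other (restrict f) r≢0 r≢γ₀
    ker∩E₀ : #ker∩E₀ f ≡ 4
    ker∩E₀ = #ker∩E₀-nonvanishing f r≢0
    ker∩E₀∖l₀ : #ker∩E₀∖l₀ f ≡ 2
    ker∩E₀∖l₀ = #ker∩E₀∖l₀-from f 2 ker∩E₀ (cong (𝟙 ∘ not) l₀⊄ker-f) refl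

  off-kernel-counts : ∀ f → f ≢ 0v →
    OffKernelCounts f 1 5 6 6 ⊎ OffKernelCounts f 0 6 8 6 ⊎ OffKernelCounts f 0 0 4 8 ⊎ OffKernelCounts f 0 0 8 8
  off-kernel-counts f f≢0 with restrict f ≟ᵥ 0ᵥ | f ≟ᵥ H₀ | restrict f ≟ᵥ γ₀
  ... | yes r≡0 | yes refl | _        = inj₂ (inj₂ (inj₂ counts-H₀))
  ... | yes r≡0 | no f≢H₀  | _        = inj₂ (inj₂ (inj₁ (counts-E₀⊆ker f f≢0 f≢H₀ r≡0)))
  ... | no r≢0  | _        | yes r≡γ₀ = inj₂ (inj₁ (counts-ker∩E₀≡l₀ f r≡γ₀))
  ... | no r≢0  | _        | no r≢γ₀  = inj₁ (counts-ker∩E₀≢l₀ f r≢0 r≢γ₀)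

  ∃-counts-ker∩E₀≢l₀-at : ∀ c → c ≢ 0ᵥ → c ≢ γ₀ → ∃[ f ] f ≢ 0v × OffKernelCounts f 1 5 6 6
  ∃-counts-ker∩E₀≢l₀-at c c≢0 c≢γ₀ =
    let f , r≡c = restrict-surjective c
        r≢0 = c≢0 ∘ trans (sym r≡c)
    in f , nonvanishing⇒≢0 f r≢0 , counts-ker∩E₀≢l₀ f r≢0 (c≢γ₀ ∘ trans (sym r≡c))

  ∃-counts-ker∩E₀≢l₀ : ∃[ f ] f ≢ 0v × OffKernelCounts f 1 5 6 6
  ∃-counts-ker∩E₀≢l₀ with γ₀ ≟ᵥ (true ∷ false ∷ false ∷ [])
  ... | yes γ₀≡e₁ =
    ∃-counts-ker∩E₀≢l₀-at (false ∷ true ∷ false ∷ []) (λ ()) (λ e₂≡γ₀ → contradiction (trans e₂≡γ₀ γ₀≡e₁) λ ())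
  ... | no  γ₀≢e₁ = ∃-counts-ker∩E₀≢l₀-at (true ∷ false ∷ false ∷ []) (λ ()) (γ₀≢e₁ ∘ sym)

  ∃-counts-ker∩E₀≡l₀ : ∃[ f ] f ≢ 0v × OffKernelCounts f 0 6 8 6
  ∃-counts-ker∩E₀≡l₀ =
    let f , r≡γ₀ = restrict-surjective γ₀
    in f , nonvanishing⇒≢0 f (dual≢0 l₀ l₀⊆E₀ ∘ trans (sym r≡γ₀)) , counts-ker∩E₀≡l₀ f r≡γ₀

  private
    vanishes-elsewhere : V5 → Bool
    vanishes-elsewhere f = restrict f ==ᵥ 0ᵥ ∧ not (f ==ᵥ 0v) ∧ not (f ==ᵥ H₀)

    #vanishes-elsewhere : ∑[ f ← allVec 5 ] 𝟙 (vanishes-elsewhere f) ≡ 2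
    #vanishes-elsewhere = +-cancelʳ-≡ 2 _ 2 (begin
      S + 2
        ≡⟨ +-assoc S 1 1 ⟨
      S + 1 + 1
        ≡⟨ cong₂ (λ x y → S + x + y) (∑-𝟙-δ 0v) (∑-𝟙-δ H₀) ⟨
      S + (∑[ f ← allVec 5 ] 𝟙 (f ==ᵥ 0v)) + (∑[ f ← allVec 5 ] 𝟙 (f ==ᵥ H₀))
        ≡⟨ cong (_+ (∑[ f ← allVec 5 ] 𝟙 (f ==ᵥ H₀))) (∑-distrib-+ (allVec 5) (𝟙 ∘ vanishes-elsewhere) (λ f → 𝟙 (f ==ᵥ 0v))) ⟨
      (∑[ f ← allVec 5 ] (𝟙 (vanishes-elsewhere f) + 𝟙 (f ==ᵥ 0v))) + (∑[ f ← allVec 5 ] 𝟙 (f ==ᵥ H₀))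
        ≡⟨ ∑-distrib-+ (allVec 5) (λ f → 𝟙 (vanishes-elsewhere f) + 𝟙 (f ==ᵥ 0v)) (λ f → 𝟙 (f ==ᵥ H₀)) ⟨
      ∑[ f ← allVec 5 ] (𝟙 (vanishes-elsewhere f) + 𝟙 (f ==ᵥ 0v) + 𝟙 (f ==ᵥ H₀))
        ≡⟨ ∑-cong (allVec 5) (λ f → sym (𝟙-split₃ (0-vanishes f) (H₀-vanishes f))) ⟩
      ∑[ f ← allVec 5 ] 𝟙 (restrict f ==ᵥ 0ᵥ)
        ≡⟨ restriction-fibre-size 0ᵥ ⟩
      4 ∎)
      where
      open ≡-Reasoning
      S : ℕ
      S = ∑[ f ← allVec 5 ] 𝟙 (vanishes-elsewhere f)
      0-vanishes : ∀ f → f ==ᵥ 0v ≡ true → restrict f ==ᵥ 0ᵥ ≡ true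
      0-vanishes f f≡0 = subst (λ g → restrict g ==ᵥ 0ᵥ ≡ true) (sym (==ᵥ⇒≡ f 0v f≡0)) (trans (cong (_==ᵥ 0ᵥ) restrict-0) (==ᵥ-refl (0ᵥ {3})))
      H₀-vanishes : ∀ f → f ==ᵥ H₀ ≡ true → restrict f ==ᵥ 0ᵥ ≡ true × f ==ᵥ 0v ≡ false
      H₀-vanishes f f≡H₀ = subst (λ g → restrict g ==ᵥ 0ᵥ ≡ true × g ==ᵥ 0v ≡ false) (sym (==ᵥ⇒≡ f H₀ f≡H₀))
        (trans (cong (_==ᵥ 0ᵥ) restrict-H₀) (==ᵥ-refl (0ᵥ {3})) , ≢⇒==ᵥ-false H₀≢0)

  ∃-counts-E₀⊆ker : ∃[ f ] f ≢ 0v × OffKernelCounts f 0 0 4 8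
  ∃-counts-E₀⊆ker =
    let f , vf = ∑-𝟙-positive⇒∃ (allVec 5) vanishes-elsewhere (subst (0 <_) (sym #vanishes-elsewhere) (s≤s z≤n))
        r≡0 = ==ᵥ⇒≡ (restrict f) 0ᵥ (∧-conicalˡ (restrict f ==ᵥ 0ᵥ) _ vf)
        f≢0 = ==ᵥ-false⇒≢ f 0v (not-injective (∧-conicalˡ (not (f ==ᵥ 0v)) _ (∧-conicalʳ (restrict f ==ᵥ 0ᵥ) _ vf)))
        f≢H₀ = ==ᵥ-false⇒≢ f H₀ (not-injective (∧-conicalʳ (not (f ==ᵥ 0v)) _ (∧-conicalʳ (restrict f ==ᵥ 0ᵥ) _ vf)))
    in f , f≢0 , counts-E₀⊆ker f f≢0 f≢H₀ r≡0

  module Code (g h v e : ℕ) where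

    C : List Line
    C = multisetC g h v e l₀ Os Vs Es

    w₁ w₂ w₃ w₄ d : ℕ
    w₁ = g + 5 * h + 6 * (v + e)
    w₂ = 6 * h + 8 * v + 6 * e
    w₃ = 4 * v + 8 * e
    w₄ = 8 * (v + e)
    d  = w₁ ⊓ (w₂ ⊓ w₃)

    wt : V5 → ℕ
    wt f = weight (codeword C f)

    weight-from-counts : ∀ {f x₀ xO xV xE} → OffKernelCounts f x₀ xO xV xE → wt f ≡ g * x₀ + (h * xO + (v * xV + e * xE))
    weight-from-counts {f} P = trans (weight-multisetC g h v e l₀ Os Vs Es f)
      (cong₂ (λ x y → g * x + y) (OffKernelCounts.l₀-off P) (cong₂ (λ x y → h * x + y) (OffKernelCounts.Os-off P)
        (cong₂ (λ x y → v * x + e * y) (OffKernelCounts.Vs-off P) (OffKernelCounts.Es-off P))))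

    counts⇒wt≡w₁ : ∀ {f} → OffKernelCounts f 1 5 6 6 → wt f ≡ w₁
    counts⇒wt≡w₁ {f} P = begin
      wt f                                 ≡⟨ weight-from-counts P ⟩
      g * 1 + (h * 5 + (v * 6 + e * 6))    ≡⟨ solve (g List.∷ h List.∷ v List.∷ e List.∷ List.[]) ⟩
      g + 5 * h + 6 * (v + e)              ∎
      where open ≡-Reasoning

    counts⇒wt≡w₂ : ∀ {f} → OffKernelCounts f 0 6 8 6 → wt f ≡ w₂
    counts⇒wt≡w₂ {f} P = begin
      wt f                                 ≡⟨ weight-from-counts P ⟩
      g * 0 + (h * 6 + (v * 8 + e * 6))    ≡⟨ solve (g List.∷ h List.∷ v List.∷ e List.∷ List.[]) ⟩
      6 * h + 8 * v + 6 * e                ∎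
      where open ≡-Reasoning

    counts⇒wt≡w₃ : ∀ {f} → OffKernelCounts f 0 0 4 8 → wt f ≡ w₃
    counts⇒wt≡w₃ {f} P = begin
      wt f                                 ≡⟨ weight-from-counts P ⟩
      g * 0 + (h * 0 + (v * 4 + e * 8))    ≡⟨ solve (g List.∷ h List.∷ v List.∷ e List.∷ List.[]) ⟩
      4 * v + 8 * e                        ∎
      where open ≡-Reasoning

    counts⇒wt≡w₄ : ∀ {f} → OffKernelCounts f 0 0 8 8 → wt f ≡ w₄
    counts⇒wt≡w₄ {f} P = begin
      wt f                                 ≡⟨ weight-from-counts P ⟩
      g * 0 + (h * 0 + (v * 8 + e * 8))    ≡⟨ solve (g List.∷ h List.∷ v List.∷ e List.∷ List.[]) ⟩
      8 * (v + e)                          ∎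
      where open ≡-Reasoning

    private
      attains : ∀ {x₀ xO xV xE w} → (∀ {f} → OffKernelCounts f x₀ xO xV xE → wt f ≡ w) →
                ∃[ f ] f ≢ 0v × OffKernelCounts f x₀ xO xV xE → ∃[ f ] f ≢ 0v × wt f ≡ w
      attains weight-of (f , f≢0 , P) = f , f≢0 , weight-of P

    w₁-attained : ∃[ f ] f ≢ 0v × wt f ≡ w₁
    w₁-attained = attains counts⇒wt≡w₁ ∃-counts-ker∩E₀≢l₀

    w₂-attained : ∃[ f ] f ≢ 0v × wt f ≡ w₂
    w₂-attained = attains counts⇒wt≡w₂ ∃-counts-ker∩E₀≡l₀

    w₃-attained : ∃[ f ] f ≢ 0v × wt f ≡ w₃
    w₃-attained = attains counts⇒wt≡w₃ ∃-counts-E₀⊆ker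

    w₄-attained : ∃[ f ] f ≢ 0v × wt f ≡ w₄
    w₄-attained = H₀ , H₀≢0 , counts⇒wt≡w₄ counts-H₀

    weights : ∀ f → f ≢ 0v → (wt f ≡ w₁) ⊎ (wt f ≡ w₂) ⊎ (wt f ≡ w₃) ⊎ (wt f ≡ w₄)
    weights f f≢0 with off-kernel-counts f f≢0
    ... | inj₁ P               = inj₁ (counts⇒wt≡w₁ P)
    ... | inj₂ (inj₁ P)        = inj₂ (inj₁ (counts⇒wt≡w₂ P))
    ... | inj₂ (inj₂ (inj₁ P)) = inj₂ (inj₂ (inj₁ (counts⇒wt≡w₃ P)))
    ... | inj₂ (inj₂ (inj₂ P)) = inj₂ (inj₂ (inj₂ (counts⇒wt≡w₄ P)))

    d≤w₂ : d ≤ w₂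
    d≤w₂ = ≤-trans (m⊓n≤n w₁ (w₂ ⊓ w₃)) (m⊓n≤m w₂ w₃)

    d≤w₃ : d ≤ w₃
    d≤w₃ = ≤-trans (m⊓n≤n w₁ (w₂ ⊓ w₃)) (m⊓n≤n w₂ w₃)

    w₃≤w₄ : w₃ ≤ w₄
    w₃≤w₄ = begin
      4 * v + 8 * e                ≤⟨ m≤m+n (4 * v + 8 * e) (4 * v) ⟩
      4 * v + 8 * e + 4 * v        ≡⟨ solve (v List.∷ e List.∷ List.[]) ⟩
      8 * (v + e)                  ∎
      where open ≤-Reasoning

    d≤wt : ∀ f → f ≢ 0v → d ≤ wt f
    d≤wt f f≢0 with weights f f≢0
    ... | inj₁ wt≡w₁               = subst (d ≤_) (sym wt≡w₁) (m⊓n≤m w₁ (w₂ ⊓ w₃))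
    ... | inj₂ (inj₁ wt≡w₂)        = subst (d ≤_) (sym wt≡w₂) d≤w₂
    ... | inj₂ (inj₂ (inj₁ wt≡w₃)) = subst (d ≤_) (sym wt≡w₃) d≤w₃
    ... | inj₂ (inj₂ (inj₂ wt≡w₄)) = subst (d ≤_) (sym wt≡w₄) (≤-trans d≤w₃ w₃≤w₄)

    d-attained : ∃[ f ] f ≢ 0v × wt f ≡ d
    d-attained = ⊓-closed (λ w → ∃[ f ] f ≢ 0v × wt f ≡ w) w₁-attained
      (⊓-closed (λ w → ∃[ f ] f ≢ 0v × wt f ≡ w) w₂-attained w₃-attained)

    injective : 0 < d → ∀ f f′ → codeword C f ≡ codeword C f′ → f ≡ f′
    injective 0<d f f′ eq = ⊕ᵥ≡0⇒≡ f f′ (decidable-stable ((f ⊕ f′) ≟ᵥ 0v) λ f⊕f′≢0 →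
      n≮0 (≤-trans 0<d (subst (d ≤_) (weight-codeword-⊕ C f f′ eq) (d≤wt (f ⊕ f′) f⊕f′≢0))))

corollary1 :
  (g h v e : ℕ)
  (l₀ : Line) (E₀ : Plane) (H₀ : V5) → H₀ ≢ 0v →
  LineInPlane l₀ E₀ → PlaneInHyperplane E₀ H₀ →
  (Os : Vec Line 6) → Distinct Os →
  ((i : Fin 6) → LineInPlane (lookup Os i) E₀ × ¬ SameLine (lookup Os i) l₀) →
  (Vs : Vec Line 8) → Distinct Vs →
  ((p : V5) → p ≢ 0v → p ∈P E₀ → onLine p l₀ ≡ false → linesThrough p Vs ≡ 2) →
  ((p : V5) → p ≢ 0v → ¬ (p ∈H H₀) → linesThrough p Vs ≡ 1) →
  (Es : Vec Line 8) → Distinct Es →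
  ((i : Fin 8) (p : V5) → onLine p (lookup Es i) ≡ true → ¬ (p ∈P E₀)) →
  ((p : V5) → p ≢ 0v → ¬ (p ∈P E₀) → linesThrough p Es ≡ 1) →
  let C  = multisetC g h v e l₀ Os Vs Es
      w₁ = g + 5 * h + 6 * (v + e)
      w₂ = 6 * h + 8 * v + 6 * e
      w₃ = 4 * v + 8 * e
      w₄ = 8 * (v + e)
      d  = w₁ ⊓ (w₂ ⊓ w₃)
      wt = λ (f : V5) → weight (codeword C f)
  in ((f : V5) → f ≢ 0v → (wt f ≡ w₁) ⊎ (wt f ≡ w₂) ⊎ (wt f ≡ w₃) ⊎ (wt f ≡ w₄))
   × (∃[ f ] (f ≢ 0v × wt f ≡ w₁)) × (∃[ f ] (f ≢ 0v × wt f ≡ w₂))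
   × (∃[ f ] (f ≢ 0v × wt f ≡ w₃)) × (∃[ f ] (f ≢ 0v × wt f ≡ w₄))
   × (length C ≡ g + 6 * h + 8 * (v + e))
   × ((f : V5) → f ≢ 0v → d ≤ wt f)
   × (∃[ f ] (f ≢ 0v × wt f ≡ d))
   × (0 < d → (f f′ : V5) → codeword C f ≡ codeword C f′ → f ≡ f′)
-- The lines of 𝒱 and of ℰ need not be known to be distinct: their point multiplicities suffice.
corollary1 g h v e l₀ E₀ H₀ H₀≢0 l₀⊆E₀ E₀⊆H₀ Os Os-distinct Os⊆E₀ Vs _ Vs-on-E₀∖l₀ Vs-off-H₀ Es _ Es-off-E₀ Es-cover =
  weights , w₁-attained , w₂-attained , w₃-attained , w₄-attained ,
  length-multisetC g h v e l₀ Os Vs Es , d≤wt , d-attained , injective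
  where
  open Configuration l₀ E₀ H₀ H₀≢0 l₀⊆E₀ E₀⊆H₀ Os Os-distinct Os⊆E₀ Vs Vs-on-E₀∖l₀ Vs-off-H₀ Es Es-off-E₀ Es-cover
  open Code g h v e
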